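{- Let $s,k$ be integers with $k>s\ge 3$ and let $G$ be a graph with pseudo-split partition $(C,S,I)$. (1) If $G$ is a minimal $(s,k)$-polar obstruction with $|C|=s$, then $G$ is a minimal $(s,k')$-polar obstruction for every integer $k'\ge k$; in particular, if $G$ is a minimal $(s,s+1)$-polar obstruction with $|C|=s$, then it is a minimal $(s,\infty)$-polar obstruction. (2) If $G$ is a minimal $(s,k)$-polar obstruction with $|C|=s$, then $G$ is a minimal $(s,s+1)$-polar obstruction; consequently, if $G$ is a minimal $(s,\infty)$-polar obstruction, then it is a minimal $(s,s+1)$-polar obstruction with $|C|=s$. Hence $G$ is a minimal $(s,\infty)$-polar obstruction if and only if $G$ is a minimal $(s,s+1)$-polar obstruction with $|C|=s$.
   Context: All graphs are finite and simple. A pseudo-split partition of $G$ is a partition $(C,S,I)$ of $V_G$ with $C$ a clique, $I$ independent, $S=\varnothing$ or $G[S]\cong C_5$, $C$ completely adjacent to $S$, and no edges between $I$ and $S$. For a nonnegative integer $s$ and $k$ a nonnegative integer or $\infty$, $G$ is $(s,k)$-polar if $V_G$ has a partition $(A,B)$ with $G[A]$ a complete multipartite graph with at most $s$ parts and $G[B]$ a disjoint union of at most $k$ complete graphs ($k=\infty$: no bound on the number of components). A minimal $(s,k)$-polar obstruction is a graph that is not $(s,k)$-polar but every vertex-deleted subgraph of which is. -}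

module Defs where

open import Data.Nat using (ℕ; zero; suc; _+_)
open import Data.Bool using (Bool; true; false; if_then_else_)
open import Data.Fin using (Fin; punchIn)
open import Data.Fin.Properties using ()
open import Data.List using (List; map)
open import Data.Nat.ListAction using (sum)
open import Data.List.Base using (allFin)
open import Data.Product using (Σ; _×_; ∃; _,_)
open import Data.Sum using (_⊎_)
open import Data.Unit using (⊤)
open import Relation.Nullary using (¬_)
open import Relation.Binary.PropositionalEquality using (_≡_; _≢_)
open import Function.Definitions using (Injective)

record Graph (n : ℕ) : Set where
  field
    adj    : Fin n → Fin n → Bool
    sym    : ∀ u v → adj u v ≡ adj v u
    irrefl : ∀ v → adj v v ≡ false
open Graph public

Adj : ∀ {n} → Graph n → Fin n → Fin n → Set
Adj G u v = adj G u v ≡ true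

deleteVertex : ∀ {m} → Graph (suc m) → Fin (suc m) → Graph m
deleteVertex G v = record
  { adj    = λ u w → adj G (punchIn v u) (punchIn v w)
  ; sym    = λ u w → sym G (punchIn v u) (punchIn v w)
  ; irrefl = λ u → irrefl G (punchIn v u)
  }

data ℕ∞ : Set where
  fin : ℕ → ℕ∞
  ∞   : ℕ∞

-- labels available for the components of G[B]
Label : ℕ∞ → Set
Label (fin k) = Fin k
Label ∞       = ℕ

-- A = {v | inA v ≡ true}, B = complement.
-- G[A] complete multipartite with ≤ s parts: part labels p into Fin s,
--   distinct u,v ∈ A adjacent iff in different parts.
-- G[B] disjoint union of ≤ k complete graphs: component labels q,
--   distinct u,v ∈ B adjacent iff same label.

Polar : ℕ → ℕ∞ → ∀ {n} → Graph n → Set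
Polar s k {n} G =
  Σ (Fin n → Bool) λ inA →
  Σ ((v : Fin n) → inA v ≡ true → Fin s) λ p →
  Σ ((v : Fin n) → inA v ≡ false → Label k) λ q →
    (∀ u v (hu : inA u ≡ true) (hv : inA v ≡ true) → u ≢ v →
       (Adj G u v → p u hu ≢ p v hv) × (p u hu ≢ p v hv → Adj G u v))
  × (∀ u v (hu : inA u ≡ false) (hv : inA v ≡ false) → u ≢ v →
       (Adj G u v → q u hu ≡ q v hv) × (q u hu ≡ q v hv → Adj G u v))

AllDeletionsPolar : ℕ → ℕ∞ → ∀ {n} → Graph n → Set
AllDeletionsPolar s k {zero}  G = ⊤
AllDeletionsPolar s k {suc m} G = ∀ v → Polar s k (deleteVertex G v)

MinimalObstruction : ℕ → ℕ∞ → ∀ {n} → Graph n → Set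
MinimalObstruction s k G = ¬ Polar s k G × AllDeletionsPolar s k G

data Part : Set where
  cC sS iI : Part

-- adjacency of the 5-cycle 0-1-2-3-4-0
C5adj : Fin 5 → Fin 5 → Bool
C5adj Fin.zero (Fin.suc Fin.zero) = true
C5adj (Fin.suc Fin.zero) Fin.zero = true
C5adj (Fin.suc Fin.zero) (Fin.suc (Fin.suc Fin.zero)) = true
C5adj (Fin.suc (Fin.suc Fin.zero)) (Fin.suc Fin.zero) = true
C5adj (Fin.suc (Fin.suc Fin.zero)) (Fin.suc (Fin.suc (Fin.suc Fin.zero))) = true
C5adj (Fin.suc (Fin.suc (Fin.suc Fin.zero))) (Fin.suc (Fin.suc Fin.zero)) = true
C5adj (Fin.suc (Fin.suc (Fin.suc Fin.zero))) (Fin.suc (Fin.suc (Fin.suc (Fin.suc Fin.zero)))) = true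
C5adj (Fin.suc (Fin.suc (Fin.suc (Fin.suc Fin.zero)))) (Fin.suc (Fin.suc (Fin.suc Fin.zero))) = true
C5adj (Fin.suc (Fin.suc (Fin.suc (Fin.suc Fin.zero)))) Fin.zero = true
C5adj Fin.zero (Fin.suc (Fin.suc (Fin.suc (Fin.suc Fin.zero)))) = true
C5adj _ _ = false

-- S = ∅ or G[S] ≅ C₅ (an injection h : Fin 5 → V onto S preserving
-- adjacency and non-adjacency)
SEmptyOrC5 : ∀ {n} → Graph n → (Fin n → Part) → Set
SEmptyOrC5 {n} G P =
    (∀ v → ¬ (P v ≡ sS))
  ⊎ Σ (Fin 5 → Fin n) λ h →
      Injective _≡_ _≡_ h
    × (∀ i → P (h i) ≡ sS)
    × (∀ v → P v ≡ sS → ∃ λ i → h i ≡ v)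
    × (∀ i j → adj G (h i) (h j) ≡ C5adj i j)

IsPseudoSplit : ∀ {n} → Graph n → (Fin n → Part) → Set
IsPseudoSplit G P =
    (∀ u v → P u ≡ cC → P v ≡ cC → u ≢ v → Adj G u v)
  × (∀ u v → P u ≡ iI → P v ≡ iI → ¬ Adj G u v)
  × SEmptyOrC5 G P
  × (∀ u v → P u ≡ cC → P v ≡ sS → Adj G u v)
  × (∀ u v → P u ≡ iI → P v ≡ sS → ¬ Adj G u v)

isC : Part → ℕ
isC cC = 1
isC sS = 0
isC iI = 0

sizeC : ∀ {n} → (Fin n → Part) → ℕ
sizeC {n} P = sum (map (λ v → isC (P v)) (allFin n))

-- Let S ≅ C₅.  In a polar partition (A, B) of a pseudo-split graph, G[A] is co-P₃-free and G[B]
-- is P₃-free, and checking where the five vertices of S may go shows that the partition has one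
-- of two shapes: either C ⊆ A, which costs |C| + 1 parts and |I₋| + 2 cliques, where I₋ are the
-- I-vertices missing some C-vertex; or C₊ ⊆ A and C ∖ C₊ lies in a clique of B together with
-- two vertices of S, which costs |C₊| + 2 parts and |I| + 1 cliques, where C₊ are the C-vertices
-- with an I-neighbour.  Conversely each count condition yields an explicit partition, so
-- (s,k)-polarity of G and of G - v becomes a matter of counting.
--
-- If G is a minimal (s,k)-obstruction with |C| = s, the first shape is impossible for every k,
-- and so is the second: if |C₊| + 2 ≤ s then k ≤ |I|, and deleting a vertex of C ∖ C₊ leaves a
-- graph that still has no (s,k)-polar partition.  So G is not (s,k′)-polar for any k′.
-- Deleting a vertex i of I must then leave |C₊(G - i)| + 2 ≤ s, i.e. i has a private
-- neighbour in C₊; these private neighbours inject I into C and force |I| < s, which is exactly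
-- what makes every G - v (s,s+1)-polar.  For k = ∞ the count conditions force |C| = s.
-- If S = ∅ the graph is split, hence polar, and is no obstruction at all.

module Submission where

open import Defs renaming (sym to adj-sym)
import Data.Bool as Bool
open import Data.Bool using (Bool; true; false; _∧_; not; if_then_else_)
open import Data.Bool.Properties using (∧-conicalˡ; ∧-conicalʳ; ∧-identityʳ; ¬-not)
open import Data.Empty using (⊥; ⊥-elim)
open import Data.Fin using (Fin; zero; suc; _≟_; fromℕ<; toℕ; punchIn; punchOut; inject≤)
open import Data.Fin.Properties
  using (any?; all?; suc-injective; fromℕ<-injective; toℕ<n; toℕ-injective; punchIn-injective; punchInᵢ≢i;
         punchIn-punchOut; punchOut-injective; inject≤-injective)
open import Data.List using (map)
open import Data.List.Base using (tabulate)
open import Data.Nat using (ℕ; zero; suc; _+_; _≤_; _<_; _⊓_; z≤n; s≤s)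
open import Data.Nat.ListAction using (sum)
open import Data.Nat.Properties
  using (module ≤-Reasoning; +-suc; +-cancelˡ-≡; +-monoʳ-<; ≤-refl; ≤-reflexive; ≤-trans; ≤-pred; ≤-antisym;
         <⇒≤; <⇒≢; <⇒≱; <-≤-trans; ≤-<-trans; ≰⇒>; ≮⇒≥; 1+n≰n; n≤1+n; m≤m+n;
         m⊓n≤n; m≤n⇒m⊓n≡m; _<?_; _≤?_)
open import Data.Product using (∃; _×_; _,_; proj₁; proj₂)
open import Data.Sum using (_⊎_; inj₁; inj₂)
import Data.Sum as Sum
open import Data.Unit using (⊤; tt)
open import Function using (_∘_; id)
open import Function.Definitions using (Injective)
open import Relation.Binary.PropositionalEquality
open import Relation.Nullary using (¬_; yes; no; Dec; does; contradiction)
open import Relation.Nullary.Decidable using (dec-true; dec-false; from-yes; _×-dec_; _→-dec_; ¬?)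

private variable n m s s′ : ℕ; k k′ : ℕ∞

count : (Fin n → Bool) → ℕ
count {zero}  X = 0
count {suc n} X = (if X zero then 1 else 0) + count (X ∘ suc)

every : Fin n → Bool
every _ = true

infixl 6 _─_

_─_ : (Fin n → Bool) → Fin n → Fin n → Bool
(X ─ a) y = X y ∧ not (does (y ≟ a))

∈─⁺ : ∀ (X : Fin n → Bool) {a y} → X y ≡ true → y ≢ a → (X ─ a) y ≡ true
∈─⁺ X {a} {y} y∈X y≢a = cong₂ _∧_ y∈X (cong not (dec-false (y ≟ a) y≢a))

∈─⁻ : ∀ (X : Fin n → Bool) {a y} → (X ─ a) y ≡ true → X y ≡ true × y ≢ a
∈─⁻ X {a} {y} e = ∧-conicalˡ _ _ e , λ y≡a →
  contradiction (trans (sym (cong not (dec-true (y ≟ a) y≡a))) (∧-conicalʳ _ _ e)) λ ()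

∃ᵇ : (Fin n → Bool) → Bool
∃ᵇ X = does (any? λ x → X x Bool.≟ true)

∃ᵇ-intro : (X : Fin n → Bool) (x : Fin n) → X x ≡ true → ∃ᵇ X ≡ true
∃ᵇ-intro X x x∈X = dec-true (any? λ x → X x Bool.≟ true) (x , x∈X)

∃ᵇ-elim : (X : Fin n → Bool) → ∃ᵇ X ≡ true → ∃ λ x → X x ≡ true
∃ᵇ-elim X e with any? (λ x → X x Bool.≟ true)
... | yes found = found
... | no _ with () ← e

∃ᵇ-false : (X : Fin n → Bool) → ∃ᵇ X ≡ false → ∀ x → X x ≢ true
∃ᵇ-false X e x x∈X = contradiction (trans (sym (∃ᵇ-intro X x x∈X)) e) λ ()

count-cong : (X Y : Fin n → Bool) → (∀ x → X x ≡ Y x) → count X ≡ count Y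
count-cong {zero}  X Y X≗Y = refl
count-cong {suc n} X Y X≗Y =
  cong₂ _+_ (cong (if_then 1 else 0) (X≗Y zero)) (count-cong (X ∘ suc) (Y ∘ suc) (X≗Y ∘ suc))

count-every : ∀ n → count (every {n}) ≡ n
count-every zero    = refl
count-every (suc n) = cong suc (count-every n)

count-─ : (X : Fin n → Bool) (a : Fin n) → X a ≡ true → count X ≡ suc (count (X ─ a))
count-─ X zero a∈X rewrite a∈X =
  cong suc (count-cong _ _ λ x → sym (∧-identityʳ (X (suc x))))
count-─ X (suc a) a∈X rewrite count-─ (X ∘ suc) a a∈X | ∧-identityʳ (X zero) =
  +-suc (if X zero then 1 else 0) _

count>0⇒∃ : (X : Fin n → Bool) → 0 < count X → ∃ λ x → X x ≡ true
count>0⇒∃ {suc n} X pos with X zero in 0∈X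
... | true  = zero , 0∈X
... | false = let x , x∈X = count>0⇒∃ (X ∘ suc) pos in suc x , x∈X

InjectiveOn : {A : Set} → (Fin n → Bool) → (Fin n → A) → Set
InjectiveOn X f = ∀ x y → X x ≡ true → X y ≡ true → f x ≡ f y → x ≡ y

≢-preserving⇒InjectiveOn : {A : Set} (X : Fin n → Bool) (f : Fin n → A) →
  (∀ x y → X x ≡ true → X y ≡ true → x ≢ y → f x ≢ f y) → InjectiveOn X f
≢-preserving⇒InjectiveOn X f pres x y x∈X y∈X fx≡fy with x ≟ y
... | yes x≡y = x≡y
... | no x≢y = contradiction fx≡fy (pres x y x∈X y∈X x≢y)

count-≤-injection : (X : Fin n → Bool) (Y : Fin m → Bool) (f : Fin n → Fin m) →
  (∀ x → X x ≡ true → Y (f x) ≡ true) → InjectiveOn X f → count X ≤ count Y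
count-≤-injection {zero} X Y f into inj = z≤n
count-≤-injection {suc n} X Y f into inj with X zero in 0∈X
... | false = count-≤-injection (X ∘ suc) Y (f ∘ suc) (into ∘ suc)
                (λ x y x∈X y∈X e → suc-injective (inj (suc x) (suc y) x∈X y∈X e))
... | true rewrite count-─ Y (f zero) (into zero 0∈X) =
  s≤s (count-≤-injection (X ∘ suc) (Y ─ f zero) (f ∘ suc)
        (λ x x∈X → ∈─⁺ Y (into (suc x) x∈X) λ e → 0≢suc (inj zero (suc x) 0∈X x∈X (sym e)))
        (λ x y x∈X y∈X e → suc-injective (inj (suc x) (suc y) x∈X y∈X e)))
  where
  0≢suc : ∀ {x : Fin n} → zero ≢ suc x
  0≢suc ()

count-mono : (X Y : Fin n → Bool) → (∀ x → X x ≡ true → Y x ≡ true) → count X ≤ count Y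
count-mono X Y X⊆Y = count-≤-injection X Y (λ x → x) X⊆Y (λ _ _ _ _ e → e)

count-<⇒∃ : (X Y : Fin n → Bool) → count X < count Y → ∃ λ y → Y y ≡ true × X y ≡ false
count-<⇒∃ X Y X<Y with any? (λ y → (Y y Bool.≟ true) ×-dec (X y Bool.≟ false))
... | yes found = found
... | no none = contradiction (count-mono Y X λ y y∈Y → ¬-not (λ y∉X → none (y , y∈Y , y∉X))) (<⇒≱ X<Y)

injection-onto : (X : Fin n → Bool) (Y : Fin m → Bool) (f : Fin n → Fin m) →
  (∀ x → X x ≡ true → Y (f x) ≡ true) → InjectiveOn X f →
  count Y ≤ count X → ∀ y → Y y ≡ true → ∃ λ x → X x ≡ true × f x ≡ y
injection-onto X Y f into inj Y≤X y y∈Y with any? (λ x → (X x Bool.≟ true) ×-dec (f x ≟ y))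
... | yes found = found
... | no none = contradiction Y≤X (<⇒≱ X<Y)
  where
  X<Y : count X < count Y
  X<Y rewrite count-─ Y y y∈Y = s≤s (count-≤-injection X (Y ─ y) f
    (λ x x∈X → ∈─⁺ Y (into x x∈X) λ e → none (x , x∈X , e)) inj)

count-avoiding₁ : (X : Fin n → Bool) (f : Fin n → Fin m) (α : Fin m) →
  (∀ x → X x ≡ true → f x ≢ α) → InjectiveOn X f → suc (count X) ≤ m
count-avoiding₁ {m = m} X f α avoid inj = begin
  suc (count X)               ≤⟨ s≤s (count-≤-injection X (every ─ α) f
                                    (λ x x∈X → ∈─⁺ (every {m}) refl (avoid x x∈X)) inj) ⟩
  suc (count (every ─ α))     ≡⟨ count-─ every α refl ⟨
  count (every {m})           ≡⟨ count-every m ⟩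
  m                           ∎
  where open ≤-Reasoning

count-avoiding₂ : (X : Fin n → Bool) (f : Fin n → Fin m) (α β : Fin m) → α ≢ β →
  (∀ x → X x ≡ true → f x ≢ α) → (∀ x → X x ≡ true → f x ≢ β) → InjectiveOn X f →
  2 + count X ≤ m
count-avoiding₂ {m = m} X f α β α≢β avoidα avoidβ inj = begin
  2 + count X                     ≤⟨ s≤s (s≤s (count-≤-injection X (every ─ α ─ β) f
                                        (λ x x∈X → ∈─⁺ (every ─ α) (∈─⁺ (every {m}) refl (avoidα x x∈X))
                                                     (avoidβ x x∈X)) inj)) ⟩
  2 + count (every ─ α ─ β)       ≡⟨ cong suc (count-─ (every ─ α) β (∈─⁺ (every {m}) refl (α≢β ∘ sym))) ⟨
  suc (count (every ─ α))         ≡⟨ count-─ every α refl ⟨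
  count (every {m})               ≡⟨ count-every m ⟩
  m                               ∎
  where open ≤-Reasoning

rank : (Fin n → Bool) → Fin n → ℕ
rank X zero    = 0
rank X (suc v) = (if X zero then 1 else 0) + rank (X ∘ suc) v

rank<count : (X : Fin n → Bool) (v : Fin n) → X v ≡ true → rank X v < count X
rank<count X zero v∈X rewrite v∈X = s≤s z≤n
rank<count X (suc v) v∈X = +-monoʳ-< (if X zero then 1 else 0) (rank<count (X ∘ suc) v v∈X)

rank-injective : (X : Fin n → Bool) → InjectiveOn X (rank X)
rank-injective X zero zero _ _ _ = refl
rank-injective X zero (suc v) u∈X _ e rewrite u∈X with () ← e
rank-injective X (suc u) zero _ v∈X e rewrite v∈X with () ← e
rank-injective X (suc u) (suc v) u∈X v∈X e =
  cong suc (rank-injective (X ∘ suc) u v u∈X v∈X (+-cancelˡ-≡ (if X zero then 1 else 0) _ _ e))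

record Enumeration (A : Set) (m : ℕ) : Set where
  field
    enum           : ℕ → A
    enum-injective : ∀ {r r′} → r < m → r′ < m → enum r ≡ enum r′ → r ≡ r′

finEnumeration : ∀ {k} → suc m ≤ k → Enumeration (Fin k) (suc m)
finEnumeration {m} {suc k} (s≤s m≤k) = record
  { enum           = λ r → fromℕ< (s≤s (m⊓n≤n r k))
  ; enum-injective = λ {r} {r′} r≤m r′≤m e → begin
      r      ≡⟨ m≤n⇒m⊓n≡m (bound r≤m) ⟨
      r ⊓ k  ≡⟨ fromℕ<-injective (r ⊓ k) (r′ ⊓ k) _ _ e ⟩
      r′ ⊓ k ≡⟨ m≤n⇒m⊓n≡m (bound r′≤m) ⟩
      r′     ∎
  }
  where
  open ≡-Reasoning
  bound : ∀ {r} → r < suc m → r ≤ k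
  bound r<m = ≤-trans (≤-pred r<m) m≤k

module _ {A : Set} {m : ℕ} (E : Enumeration A m) where
  open Enumeration E

  enum-offset-≢ : (X : Fin n → Bool) {i j : ℕ} {u : Fin n} → i < j → j + count X ≤ m →
                  X u ≡ true → enum i ≢ enum (j + rank X u)
  enum-offset-≢ X {i} {j} {u} i<j bound u∈X e =
    <⇒≢ (<-≤-trans i<j (m≤m+n j (rank X u)))
        (enum-injective (<-≤-trans i<j (≤-trans (m≤m+n j (count X)) bound)) rank-bound e)
    where
    rank-bound : j + rank X u < m
    rank-bound = <-≤-trans (+-monoʳ-< j (rank<count X u u∈X)) bound

  enum-toℕ-injective : ∀ {j} → j ≤ m → Injective _≡_ _≡_ (enum ∘ toℕ {j})
  enum-toℕ-injective j≤m {i} {i′} e =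
    toℕ-injective (enum-injective (<-≤-trans (toℕ<n i) j≤m) (<-≤-trans (toℕ<n i′) j≤m) e)

  enum-rank-≢ : (X : Fin n → Bool) (j : ℕ) {u w : Fin n} → j + count X ≤ m →
                X u ≡ true → X w ≡ true → u ≢ w → enum (j + rank X u) ≢ enum (j + rank X w)
  enum-rank-≢ X j {u} {w} bound u∈X w∈X u≢w e =
    u≢w (rank-injective X u w u∈X w∈X (+-cancelˡ-≡ j _ _ (enum-injective (rank-bound u∈X) (rank-bound w∈X) e)))
    where
    rank-bound : ∀ {v} → X v ≡ true → j + rank X v < m
    rank-bound {v} v∈X = <-≤-trans (+-monoʳ-< j (rank<count X v v∈X)) bound

Fin1-injective : {A : Set} (f : Fin 1 → A) → Injective _≡_ _≡_ f
Fin1-injective f {zero} {zero} _ = refl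

invert : (Fin (suc m) → Fin n) → Fin n → Fin (suc m)
invert h y with any? (λ i → h i ≟ y)
... | yes (i , _) = i
... | no _        = zero

invert-cancel : (h : Fin (suc m) → Fin n) → Injective _≡_ _≡_ h → ∀ i → invert h (h i) ≡ i
invert-cancel h h-inj i with any? (λ j → h j ≟ h i)
... | yes (j , hj≡hi) = h-inj hj≡hi
... | no none         = contradiction (i , refl) none

-- Polar partitions as labellings

-- inj₁ p : the vertex lies in part p of G[A];  inj₂ q : it lies in clique q of G[B]

Tag : ℕ → ℕ∞ → Set
Tag s k = Fin s ⊎ Label k

Agrees : Tag s k → Tag s k → Set → Set
Agrees (inj₁ p) (inj₁ p′) A = (A → p ≢ p′) × (p ≢ p′ → A)
Agrees (inj₂ q) (inj₂ q′) A = (A → q ≡ q′) × (q ≡ q′ → A)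
Agrees (inj₁ _) (inj₂ _)  A = ⊤
Agrees (inj₂ _) (inj₁ _)  A = ⊤

Agrees-sym : ∀ {A B : Set} (x y : Tag s k) → (A → B) → (B → A) → Agrees x y A → Agrees y x B
Agrees-sym (inj₁ p) (inj₁ p′) A⇒B B⇒A (A⇒≢ , ≢⇒A) =
  (λ b → A⇒≢ (B⇒A b) ∘ sym) , λ p′≢p → A⇒B (≢⇒A (p′≢p ∘ sym))
Agrees-sym (inj₂ q) (inj₂ q′) A⇒B B⇒A (A⇒≡ , ≡⇒A) =
  (λ b → sym (A⇒≡ (B⇒A b))) , λ e → A⇒B (≡⇒A (sym e))
Agrees-sym (inj₁ _) (inj₂ _) _ _ _ = tt
Agrees-sym (inj₂ _) (inj₁ _) _ _ _ = tt

PolarOn : (s : ℕ) (k : ℕ∞) → Graph n → (Fin n → Bool) → (Fin n → Tag s k) → Set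
PolarOn s k G K L = ∀ u w → K u ≡ true → K w ≡ true → u ≢ w → Agrees (L u) (L w) (Adj G u w)

labelling⇒polar : (G : Graph n) (L : Fin n → Tag s k) → PolarOn s k G every L → Polar s k G
labelling⇒polar {s = s} {k = k} G L polarOn =
    (λ u → inA? (L u)) , (λ u → part (L u)) , (λ u → clique (L u))
  , (λ u w u∈A w∈A u≢w → agreeA (L u) (L w) u∈A w∈A (polarOn u w refl refl u≢w))
  , (λ u w u∈B w∈B u≢w → agreeB (L u) (L w) u∈B w∈B (polarOn u w refl refl u≢w))
  where
  inA? : Tag s k → Bool
  inA? (inj₁ _) = true
  inA? (inj₂ _) = false
  part : (x : Tag s k) → inA? x ≡ true → Fin s
  part (inj₁ p) _ = p
  clique : (x : Tag s k) → inA? x ≡ false → Label k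
  clique (inj₂ q) _ = q
  agreeA : ∀ {A} x y (x∈A : inA? x ≡ true) (y∈A : inA? y ≡ true) → Agrees x y A →
           (A → part x x∈A ≢ part y y∈A) × (part x x∈A ≢ part y y∈A → A)
  agreeA (inj₁ _) (inj₁ _) _ _ agrees = agrees
  agreeB : ∀ {A} x y (x∈B : inA? x ≡ false) (y∈B : inA? y ≡ false) → Agrees x y A →
           (A → clique x x∈B ≡ clique y y∈B) × (clique x x∈B ≡ clique y y∈B → A)
  agreeB (inj₂ _) (inj₂ _) _ _ agrees = agrees

polar⇒labelling : (G : Graph n) → Polar s k G → ∃ λ L → PolarOn s k G every L
polar⇒labelling {n} {s} {k} G (inA , part , clique , agreeA , agreeB) = L , polarOn
  where
  tag : (u : Fin n) (b : Bool) → inA u ≡ b → Tag s k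
  tag u true  u∈A = inj₁ (part u u∈A)
  tag u false u∈B = inj₂ (clique u u∈B)
  L : Fin n → Tag s k
  L u = tag u (inA u) refl
  agrees : ∀ u w b (e : inA u ≡ b) b′ (e′ : inA w ≡ b′) → u ≢ w →
           Agrees (tag u b e) (tag w b′ e′) (Adj G u w)
  agrees u w true  e true  e′ u≢w = agreeA u w e e′ u≢w
  agrees u w false e false e′ u≢w = agreeB u w e e′ u≢w
  agrees u w true  e false e′ u≢w = tt
  agrees u w false e true  e′ u≢w = tt
  polarOn : PolarOn s k G every L
  polarOn u w _ _ = agrees u w (inA u) refl (inA w) refl

labelling⇒deletion-polar : (G : Graph (suc m)) (v : Fin (suc m)) (L : Fin (suc m) → Tag s k) →
  PolarOn s k G (every ─ v) L → Polar s k (deleteVertex G v)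
labelling⇒deletion-polar G v L polarOn = labelling⇒polar (deleteVertex G v) (L ∘ punchIn v)
  λ u w _ _ u≢w → polarOn (punchIn v u) (punchIn v w)
    (∈─⁺ every refl (punchInᵢ≢i v u)) (∈─⁺ every refl (punchInᵢ≢i v w)) (u≢w ∘ punchIn-injective v u w)

deletion-polar⇒labelling : (G : Graph (suc m)) (v : Fin (suc m)) → Tag s k →
  Polar s k (deleteVertex G v) → ∃ λ L → PolarOn s k G (every ─ v) L
deletion-polar⇒labelling {m} {s} {k} G v default pol = L′ , polarOn′
  where
  L = proj₁ (polar⇒labelling (deleteVertex G v) pol)
  tag : (u : Fin (suc m)) → Dec (u ≡ v) → Tag s k
  tag u (yes _)  = default
  tag u (no u≢v) = L (punchOut (u≢v ∘ sym))
  L′ : Fin (suc m) → Tag s k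
  L′ u = tag u (u ≟ v)
  agrees : ∀ u w (u≟v : Dec (u ≡ v)) (w≟v : Dec (w ≡ v)) → u ≢ v → w ≢ v → u ≢ w →
           Agrees (tag u u≟v) (tag w w≟v) (Adj G u w)
  agrees u w (yes u≡v) _ u≢v _ _ = contradiction u≡v u≢v
  agrees u w (no _) (yes w≡v) _ w≢v _ = contradiction w≡v w≢v
  agrees u w (no u≢v) (no w≢v) _ _ u≢w =
    subst₂ (λ a b → Agrees (L (punchOut (u≢v ∘ sym))) (L (punchOut (w≢v ∘ sym))) (Adj G a b))
      (punchIn-punchOut (u≢v ∘ sym)) (punchIn-punchOut (w≢v ∘ sym))
      (proj₂ (polar⇒labelling (deleteVertex G v) pol) _ _ refl refl
        (u≢w ∘ punchOut-injective (u≢v ∘ sym) (w≢v ∘ sym)))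
  polarOn′ : PolarOn s k G (every ─ v) L′
  polarOn′ u w u∈K w∈K = agrees u w (u ≟ v) (w ≟ v) (proj₂ (∈─⁻ every u∈K)) (proj₂ (∈─⁻ every w∈K))

polar-mono : ∀ {k k′} (G : Graph n) → k ≤ k′ → Polar s (fin k) G → Polar s (fin k′) G
polar-mono G k≤k′ (inA , part , clique , agreeA , agreeB) =
  inA , part , (λ u u∈B → inject≤ (clique u u∈B) k≤k′) , agreeA ,
  λ u w u∈B w∈B u≢w → let ⇒≡ , ≡⇒ = agreeB u w u∈B w∈B u≢w in
    cong (λ q → inject≤ q k≤k′) ∘ ⇒≡ , ≡⇒ ∘ inject≤-injective k≤k′ k≤k′ _ _

polar-fin⇒∞ : ∀ {k} (G : Graph n) → Polar s (fin k) G → Polar s ∞ G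
polar-fin⇒∞ G (inA , part , clique , agreeA , agreeB) =
  inA , part , (λ u u∈B → toℕ (clique u u∈B)) , agreeA ,
  λ u w u∈B w∈B u≢w → let ⇒≡ , ≡⇒ = agreeB u w u∈B w∈B u≢w in
    cong toℕ ∘ ⇒≡ , ≡⇒ ∘ toℕ-injective

allDeletionsPolar-map : ∀ {k k′} → (∀ {m} (H : Graph m) → Polar s k H → Polar s k′ H) →
  (G : Graph n) → AllDeletionsPolar s k G → AllDeletionsPolar s k′ G
allDeletionsPolar-map {n = zero}  f G _ = tt
allDeletionsPolar-map {n = suc m} f G dels v = f (deleteVertex G v) (dels v)

infix 4 _≤∞_

_≤∞_ : ℕ → ℕ∞ → Set
m ≤∞ fin k = m ≤ k
m ≤∞ ∞     = ⊤

labelEnumeration : ∀ k → suc m ≤∞ k → Enumeration (Label k) (suc m)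
labelEnumeration (fin k) m<k = finEnumeration m<k
labelEnumeration ∞       _   = record { enum = λ r → r ; enum-injective = λ _ _ e → e }

count-avoiding₁∞ : ∀ k (X : Fin n → Bool) (f : Fin n → Label k) (α : Label k) →
  (∀ x → X x ≡ true → f x ≢ α) → InjectiveOn X f → suc (count X) ≤∞ k
count-avoiding₁∞ (fin k) = count-avoiding₁
count-avoiding₁∞ ∞ _ _ _ _ _ = tt

count-avoiding₂∞ : ∀ k (X : Fin n → Bool) (f : Fin n → Label k) (α β : Label k) → α ≢ β →
  (∀ x → X x ≡ true → f x ≢ α) → (∀ x → X x ≡ true → f x ≢ β) → InjectiveOn X f →
  2 + count X ≤∞ k
count-avoiding₂∞ (fin k) = count-avoiding₂
count-avoiding₂∞ ∞ _ _ _ _ _ _ _ _ = tt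

adj⇒≢ : (G : Graph n) {u w : Fin n} → Adj G u w → u ≢ w
adj⇒≢ G {u} uw refl = contradiction (trans (sym (irrefl G u)) uw) λ ()

module PolarLabelling {G : Graph n} {K : Fin n → Bool} {L : Fin n → Tag s k}
                      (polarOn : PolarOn s k G K L) where

  agreesAt : ∀ {u w x y} → K u ≡ true → K w ≡ true → u ≢ w → L u ≡ x → L w ≡ y →
             Agrees x y (Adj G u w)
  agreesAt {u} {w} u∈K w∈K u≢w refl refl = polarOn u w u∈K w∈K u≢w

  adjacent⇒parts≢ : ∀ {u w p p′} → K u ≡ true → K w ≡ true → L u ≡ inj₁ p → L w ≡ inj₁ p′ →
                    Adj G u w → p ≢ p′
  adjacent⇒parts≢ u∈K w∈K Lu Lw uw = proj₁ (agreesAt u∈K w∈K (adj⇒≢ G uw) Lu Lw) uw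

  nonadjacent⇒parts≡ : ∀ {u w p p′} → K u ≡ true → K w ≡ true → u ≢ w → L u ≡ inj₁ p → L w ≡ inj₁ p′ →
                       ¬ Adj G u w → p ≡ p′
  nonadjacent⇒parts≡ {p = p} {p′} u∈K w∈K u≢w Lu Lw ¬uw with p ≟ p′
  ... | yes p≡p′ = p≡p′
  ... | no p≢p′ = contradiction (proj₂ (agreesAt u∈K w∈K u≢w Lu Lw) p≢p′) ¬uw

  adjacent⇒cliques≡ : ∀ {u w q q′} → K u ≡ true → K w ≡ true → L u ≡ inj₂ q → L w ≡ inj₂ q′ →
                      Adj G u w → q ≡ q′
  adjacent⇒cliques≡ u∈K w∈K Lu Lw uw = proj₁ (agreesAt u∈K w∈K (adj⇒≢ G uw) Lu Lw) uw

  nonadjacent⇒cliques≢ : ∀ {u w q q′} → K u ≡ true → K w ≡ true → u ≢ w → L u ≡ inj₂ q → L w ≡ inj₂ q′ →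
                         ¬ Adj G u w → q ≢ q′
  nonadjacent⇒cliques≢ u∈K w∈K u≢w Lu Lw ¬uw = ¬uw ∘ proj₂ (agreesAt u∈K w∈K u≢w Lu Lw)

  B-side-P₃-free : ∀ {a b c q q′ q″} → K a ≡ true → K b ≡ true → K c ≡ true → a ≢ c →
                   L a ≡ inj₂ q → L b ≡ inj₂ q′ → L c ≡ inj₂ q″ → Adj G a b → Adj G b c → Adj G a c
  B-side-P₃-free a∈K b∈K c∈K a≢c La Lb Lc ab bc =
    proj₂ (agreesAt a∈K c∈K a≢c La Lc)
      (trans (adjacent⇒cliques≡ a∈K b∈K La Lb ab) (adjacent⇒cliques≡ b∈K c∈K Lb Lc bc))

  A-side-co-P₃-free : ∀ {a b c p p′ p″} → K a ≡ true → K b ≡ true → K c ≡ true → c ≢ a → c ≢ b →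
                      L a ≡ inj₁ p → L b ≡ inj₁ p′ → L c ≡ inj₁ p″ →
                      Adj G a b → ¬ Adj G c a → ¬ Adj G c b → ⊥
  A-side-co-P₃-free a∈K b∈K c∈K c≢a c≢b La Lb Lc ab ¬ca ¬cb =
    adjacent⇒parts≢ a∈K b∈K La Lb ab
      (trans (sym (nonadjacent⇒parts≡ c∈K a∈K c≢a Lc La ¬ca)) (nonadjacent⇒parts≡ c∈K b∈K c≢b Lc Lb ¬cb))

Agrees-map : ∀ {A : Set} {f : Fin s → Fin s′} {g : Label k → Label k′} →
  Injective _≡_ _≡_ f → Injective _≡_ _≡_ g →
  ∀ x y → Agrees x y A → Agrees (Sum.map f g x) (Sum.map f g y) A
Agrees-map {f = f} f-inj g-inj (inj₁ p) (inj₁ p′) (⇒≢ , ≢⇒) =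
  (λ a → ⇒≢ a ∘ f-inj) , λ fp≢fp′ → ≢⇒ (fp≢fp′ ∘ cong f)
Agrees-map {g = g} f-inj g-inj (inj₂ q) (inj₂ q′) (⇒≡ , ≡⇒) = cong g ∘ ⇒≡ , ≡⇒ ∘ g-inj
Agrees-map f-inj g-inj (inj₁ _) (inj₂ _) _ = tt
Agrees-map f-inj g-inj (inj₂ _) (inj₁ _) _ = tt

agrees? : ∀ {k} {A : Set} (x y : Tag s (fin k)) → Dec A → Dec (Agrees x y A)
agrees? (inj₁ p) (inj₁ p′) A? = (A? →-dec ¬? (p ≟ p′)) ×-dec (¬? (p ≟ p′) →-dec A?)
agrees? (inj₂ q) (inj₂ q′) A? = (A? →-dec (q ≟ q′)) ×-dec ((q ≟ q′) →-dec A?)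
agrees? (inj₁ _) (inj₂ _) _ = yes tt
agrees? (inj₂ _) (inj₁ _) _ = yes tt

C5Labelling : (Fin 5 → Bool) → (Fin 5 → Tag s k) → Set
C5Labelling keep T =
  ∀ i j → keep i ≡ true → keep j ≡ true → i ≢ j → Agrees (T i) (T j) (C5adj i j ≡ true)

c5Labelling? : ∀ {k} (keep : Fin 5 → Bool) (T : Fin 5 → Tag s (fin k)) → Dec (C5Labelling keep T)
c5Labelling? keep T = all? λ i → all? λ j →
  (keep i Bool.≟ true) →-dec ((keep j Bool.≟ true) →-dec
    (¬? (i ≟ j) →-dec agrees? (T i) (T j) (C5adj i j Bool.≟ true)))

C5Labelling-map : ∀ {f : Fin s → Fin s′} {g : Label k → Label k′} {keep : Fin 5 → Bool}
  {T : Fin 5 → Tag s k} → Injective _≡_ _≡_ f → Injective _≡_ _≡_ g →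
  C5Labelling keep T → C5Labelling keep (Sum.map f g ∘ T)
C5Labelling-map {T = T} f-inj g-inj valid i j i∈ j∈ i≢j =
  Agrees-map f-inj g-inj (T i) (T j) (valid i j i∈ j∈ i≢j)

Agrees-freshPart : ∀ {A : Set} {f : Fin s′ → Fin s} {g : Label k′ → Label k} {p} →
  A → (∀ i → p ≢ f i) → ∀ t → Agrees (inj₁ p) (Sum.map f g t) A
Agrees-freshPart a fresh (inj₁ i) = (λ _ → fresh i) , λ _ → a
Agrees-freshPart a fresh (inj₂ _) = tt

Agrees-freshClique : ∀ {A : Set} {f : Fin s′ → Fin s} {g : Label k′ → Label k} {q} →
  ¬ A → (∀ i → g i ≢ q) → ∀ t → Agrees (Sum.map f g t) (inj₂ q) A
Agrees-freshClique ¬a fresh (inj₁ _) = tt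
Agrees-freshClique ¬a fresh (inj₂ i) = (λ a → contradiction a ¬a) , λ e → contradiction e (fresh i)

Agrees-samePart : ∀ {A : Set} {g : Label k′ → Label k} {p : Fin s} →
  ¬ A → ∀ (t : Tag 1 k′) → Agrees (Sum.map (λ _ → p) g t) (inj₁ p) A
Agrees-samePart ¬a (inj₁ _) = (λ a → contradiction a ¬a) , λ p≢p → contradiction refl p≢p
Agrees-samePart ¬a (inj₂ _) = tt

Agrees-sameClique : ∀ {A : Set} {f : Fin s′ → Fin s} {q : Label k} →
  A → ∀ (t : Tag s′ (fin 1)) → Agrees (inj₂ q) (Sum.map f (λ _ → q) t) A
Agrees-sameClique a (inj₁ _) = tt
Agrees-sameClique a (inj₂ _) = (λ _ → refl) , λ _ → a

isCᵇ isIᵇ : Part → Bool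
isCᵇ cC = true
isCᵇ _  = false

isIᵇ iI = true
isIᵇ _  = false

isCᵇ⁻ : ∀ {x} → isCᵇ x ≡ true → x ≡ cC
isCᵇ⁻ {cC} _ = refl

isIᵇ⁻ : ∀ {x} → isIᵇ x ≡ true → x ≡ iI
isIᵇ⁻ {iI} _ = refl

∧-falseʳ : ∀ {a b} → a ≡ true → a ∧ b ≡ false → b ≡ false
∧-falseʳ refl a∧b≡false = a∧b≡false

sizeC≡count : ∀ {n} (P : Fin n → Part) → sizeC P ≡ count (λ v → isCᵇ (P v) ∧ true)
sizeC≡count {n} P = along id
  where
  isC≡ : ∀ x → isC x ≡ (if isCᵇ x ∧ true then 1 else 0)
  isC≡ cC = refl
  isC≡ sS = refl
  isC≡ iI = refl
  along : ∀ {m} (t : Fin m → Fin n) →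
          sum (map (isC ∘ P) (tabulate t)) ≡ count (λ v → isCᵇ (P (t v)) ∧ true)
  along {zero}  t = refl
  along {suc m} t = cong₂ _+_ (isC≡ (P (t zero))) (along (t ∘ suc))

module PseudoSplitGraph {n} (G : Graph n) (P : Fin n → Part) (ps : IsPseudoSplit G P) where

  C-clique : ∀ u w → P u ≡ cC → P w ≡ cC → u ≢ w → Adj G u w
  C-clique = proj₁ ps

  I-independent : ∀ u w → P u ≡ iI → P w ≡ iI → ¬ Adj G u w
  I-independent = proj₁ (proj₂ ps)

  C-complete-to-S : ∀ u w → P u ≡ cC → P w ≡ sS → Adj G u w
  C-complete-to-S = proj₁ (proj₂ (proj₂ (proj₂ ps)))

  I-anticomplete-to-S : ∀ u w → P u ≡ iI → P w ≡ sS → ¬ Adj G u w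
  I-anticomplete-to-S = proj₂ (proj₂ (proj₂ (proj₂ ps)))

  Adj-sym : ∀ {u w} → Adj G u w → Adj G w u
  Adj-sym {u} {w} uw = trans (adj-sym G w u) uw

  parts≢⇒≢ : ∀ {u w a b} → P u ≡ a → P w ≡ b → a ≢ b → u ≢ w
  parts≢⇒≢ Pu Pw a≢b refl = a≢b (trans (sym Pu) Pw)

  C∩ I∩ C₊ I₋ : (Fin n → Bool) → Fin n → Bool
  C∩ K u = isCᵇ (P u) ∧ K u
  I∩ K u = isIᵇ (P u) ∧ K u
  C₊ K c = C∩ K c ∧ ∃ᵇ (λ u → I∩ K u ∧ adj G c u)
  I₋ K u = I∩ K u ∧ ∃ᵇ (λ c → C∩ K c ∧ not (adj G c u))

  module Membership (K : Fin n → Bool) where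

    C∩⁺ : ∀ {c} → P c ≡ cC → K c ≡ true → C∩ K c ≡ true
    C∩⁺ Pc c∈K = cong₂ _∧_ (cong isCᵇ Pc) c∈K

    C∩⁻ : ∀ {c} → C∩ K c ≡ true → P c ≡ cC × K c ≡ true
    C∩⁻ e = isCᵇ⁻ (∧-conicalˡ _ _ e) , ∧-conicalʳ _ _ e

    I∩⁺ : ∀ {u} → P u ≡ iI → K u ≡ true → I∩ K u ≡ true
    I∩⁺ Pu u∈K = cong₂ _∧_ (cong isIᵇ Pu) u∈K

    I∩⁻ : ∀ {u} → I∩ K u ≡ true → P u ≡ iI × K u ≡ true
    I∩⁻ e = isIᵇ⁻ (∧-conicalˡ _ _ e) , ∧-conicalʳ _ _ e

    C₊⁺ : ∀ {c u} → C∩ K c ≡ true → I∩ K u ≡ true → Adj G c u → C₊ K c ≡ true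
    C₊⁺ {c} {u} c∈ u∈ cu = cong₂ _∧_ c∈ (∃ᵇ-intro (λ u → I∩ K u ∧ adj G c u) u (cong₂ _∧_ u∈ cu))

    C₊⁻ : ∀ {c} → C₊ K c ≡ true → C∩ K c ≡ true × ∃ λ u → I∩ K u ≡ true × Adj G c u
    C₊⁻ {c} e =
      let u , u∈ = ∃ᵇ-elim (λ u → I∩ K u ∧ adj G c u) (∧-conicalʳ _ _ e)
      in ∧-conicalˡ _ _ e , u , ∧-conicalˡ _ _ u∈ , ∧-conicalʳ _ _ u∈

    C₊-false : ∀ {c u} → C∩ K c ≡ true → C₊ K c ≡ false → I∩ K u ≡ true → ¬ Adj G c u
    C₊-false {c} {u} c∈ c∉ u∈ cu =
      ∃ᵇ-false (λ u → I∩ K u ∧ adj G c u) (∧-falseʳ c∈ c∉) u (cong₂ _∧_ u∈ cu)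

    I₋⁻ : ∀ {u} → I₋ K u ≡ true → I∩ K u ≡ true × ∃ λ c → C∩ K c ≡ true × ¬ Adj G c u
    I₋⁻ {u} e =
      let c , c∈ = ∃ᵇ-elim (λ c → C∩ K c ∧ not (adj G c u)) (∧-conicalʳ _ _ e)
      in ∧-conicalˡ _ _ e , c , ∧-conicalˡ _ _ c∈ ,
         λ cu → contradiction (trans (cong not (sym cu)) (∧-conicalʳ _ _ c∈)) λ ()

    I₋-false : ∀ {u c} → I∩ K u ≡ true → I₋ K u ≡ false → C∩ K c ≡ true → Adj G c u
    I₋-false {u} {c} u∈ u∉ c∈ with adj G c u in cu
    ... | true  = refl
    ... | false = contradiction (cong₂ _∧_ c∈ (cong not cu))
                    (∃ᵇ-false (λ c → C∩ K c ∧ not (adj G c u)) (∧-falseʳ u∈ u∉) c)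

  AgreesBetween : ∀ {s k} → (Fin n → Bool) → (Fin n → Tag s k) → Part → Part → Set
  AgreesBetween K L a b =
    ∀ u w → K u ≡ true → K w ≡ true → u ≢ w → P u ≡ a → P w ≡ b → Agrees (L u) (L w) (Adj G u w)

  polarOn-byParts : ∀ {s k} {K : Fin n → Bool} {L : Fin n → Tag s k} →
    AgreesBetween K L cC cC → AgreesBetween K L cC sS → AgreesBetween K L cC iI →
    AgreesBetween K L sS sS → AgreesBetween K L sS iI → AgreesBetween K L iI iI → PolarOn s k G K L
  polarOn-byParts {L = L} CC CS CI SS SI II u w u∈K w∈K u≢w with P u in Pu | P w in Pw
  ... | cC | cC = CC u w u∈K w∈K u≢w Pu Pw
  ... | cC | sS = CS u w u∈K w∈K u≢w Pu Pw
  ... | cC | iI = CI u w u∈K w∈K u≢w Pu Pw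
  ... | sS | sS = SS u w u∈K w∈K u≢w Pu Pw
  ... | sS | iI = SI u w u∈K w∈K u≢w Pu Pw
  ... | iI | iI = II u w u∈K w∈K u≢w Pu Pw
  ... | sS | cC = Agrees-sym (L w) (L u) Adj-sym Adj-sym (CS w u w∈K u∈K (u≢w ∘ sym) Pw Pu)
  ... | iI | cC = Agrees-sym (L w) (L u) Adj-sym Adj-sym (CI w u w∈K u∈K (u≢w ∘ sym) Pw Pu)
  ... | iI | sS = Agrees-sym (L w) (L u) Adj-sym Adj-sym (SI w u w∈K u∈K (u≢w ∘ sym) Pw Pu)

  split⇒polar : ∀ {s k} → (∀ v → P v ≢ sS) → Fin s → Label k → Polar s k G
  split⇒polar {s} {k} noS p q = labelling⇒polar G L (polarOn-byParts CC CS CI SS SI II)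
    where
    tag : Part → Tag s k
    tag cC = inj₂ q
    tag _  = inj₁ p
    L : Fin n → Tag s k
    L u = tag (P u)
    CC : AgreesBetween every L cC cC
    CC u w _ _ u≢w Pu Pw rewrite Pu | Pw = (λ _ → refl) , λ _ → C-clique u w Pu Pw u≢w
    CS : AgreesBetween every L cC sS
    CS _ w _ _ _ _ Pw = contradiction Pw (noS w)
    CI : AgreesBetween every L cC iI
    CI _ _ _ _ _ Pu Pw rewrite Pu | Pw = tt
    SS : AgreesBetween every L sS sS
    SS u _ _ _ _ Pu _ = contradiction Pu (noS u)
    SI : AgreesBetween every L sS iI
    SI u _ _ _ _ Pu _ = contradiction Pu (noS u)
    II : AgreesBetween every L iI iI
    II u w _ _ _ Pu Pw rewrite Pu | Pw =
      (λ uw → contradiction uw (I-independent u w Pu Pw)) , λ p≢p → contradiction refl p≢p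

  -- the costs of the two shapes of a polar partition of G[K] when S ⊆ K
  CliqueOnA CliqueSplit PolarityCondition : ℕ → ℕ∞ → (Fin n → Bool) → Set
  CliqueOnA   s k K = count (C∩ K) < s × 2 + count (I₋ K) ≤∞ k
  CliqueSplit s k K = 2 + count (C₊ K) ≤ s × suc (count (I∩ K)) ≤∞ k
  PolarityCondition s k K = CliqueOnA s k K ⊎ CliqueSplit s k K

-- The case G[S] ≅ C₅

pattern i0 = zero
pattern i1 = suc zero
pattern i2 = suc (suc zero)
pattern i3 = suc (suc (suc zero))
pattern i4 = suc (suc (suc (suc zero)))

module WithC5 {n} (G : Graph n) (P : Fin n → Part) (ps : IsPseudoSplit G P)
  (h : Fin 5 → Fin n) (h-injective : Injective _≡_ _≡_ h) (h∈S : ∀ i → P (h i) ≡ sS)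
  (S⊆h : ∀ v → P v ≡ sS → ∃ λ i → h i ≡ v) (h-adj : ∀ i j → adj G (h i) (h j) ≡ C5adj i j) where

  open PseudoSplitGraph G P ps

  h-Adj : ∀ {i j} → C5adj i j ≡ true → Adj G (h i) (h j)
  h-Adj {i} {j} e = trans (h-adj i j) e

  h-¬Adj : ∀ {i j} → C5adj i j ≡ false → ¬ Adj G (h i) (h j)
  h-¬Adj {i} {j} e hij = contradiction (trans (sym e) (trans (sym (h-adj i j)) hij)) λ ()

  I≢S : ∀ {u} j → P u ≡ iI → u ≢ h j
  I≢S j Pu = parts≢⇒≢ Pu (h∈S j) λ ()

  C≢I : ∀ {c u} → P c ≡ cC → P u ≡ iI → c ≢ u
  C≢I Pc Pu = parts≢⇒≢ Pc Pu λ ()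

  -- partOr and cliqueOr read a tag with a junk default; they are only applied to tags known to lie
  -- on the corresponding side
  partOr : ∀ {s k} → Fin s → Tag s k → Fin s
  partOr _ (inj₁ p) = p
  partOr d (inj₂ _) = d

  cliqueOr : ∀ {s k} → Label k → Tag s k → Label k
  cliqueOr d (inj₁ _) = d
  cliqueOr _ (inj₂ q) = q

  index : Fin n → Fin 5
  index = invert h

  index-h : ∀ i → index (h i) ≡ i
  index-h = invert-cancel h h-injective

  S-agrees : ∀ {s k} {keep : Fin 5 → Bool} {T : Fin 5 → Tag s k} → C5Labelling keep T →
    ∀ {u w} → P u ≡ sS → P w ≡ sS → u ≢ w → keep (index u) ≡ true → keep (index w) ≡ true →
    Agrees (T (index u)) (T (index w)) (Adj G u w)
  S-agrees valid {u} {w} Pu Pw u≢w ku kw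
    with i , refl ← S⊆h u Pu | j , refl ← S⊆h w Pw
    rewrite index-h i | index-h j | h-adj i j =
    valid i j ku kw (u≢w ∘ cong h)

  module NecessaryCondition {s k} {K : Fin n → Bool} (S⊆K : ∀ i → K (h i) ≡ true)
                {L : Fin n → Tag s k} (polarOn : PolarOn s k G K L) where

    open PolarLabelling {G = G} {K = K} {L = L} polarOn
    open Membership K

    C-adj-S : ∀ {c} j → P c ≡ cC × K c ≡ true → Adj G c (h j)
    C-adj-S {c} j (Pc , _) = C-complete-to-S c (h j) Pc (h∈S j)

    I-¬adj-S : ∀ {u} j → P u ≡ iI × K u ≡ true → ¬ Adj G u (h j)
    I-¬adj-S {u} j (Pu , _) = I-anticomplete-to-S u (h j) Pu (h∈S j)

    cliqueOnA-from : ∀ {x d z α β γ} → L (h x) ≡ inj₁ α → L (h d) ≡ inj₂ β → L (h z) ≡ inj₂ γ →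
                     d ≢ z → C5adj d z ≡ false → CliqueOnA s k K
    cliqueOnA-from {x} {d} {z} {α} {β} {γ} Lx Ld Lz d≢z ¬dz =
        count-avoiding₁ (C∩ K) (partOr α ∘ L) α
          (λ c c∈ → adjacent⇒parts≢ (proj₂ (C∩⁻ c∈)) (S⊆K x) (C-in-A c∈) Lx (C-adj-S x (C∩⁻ c∈)))
          (≢-preserving⇒InjectiveOn (C∩ K) (partOr α ∘ L) λ c c′ c∈ c′∈ c≢c′ →
            adjacent⇒parts≢ (proj₂ (C∩⁻ c∈)) (proj₂ (C∩⁻ c′∈)) (C-in-A c∈) (C-in-A c′∈)
              (C-clique c c′ (proj₁ (C∩⁻ c∈)) (proj₁ (C∩⁻ c′∈)) c≢c′))
      , count-avoiding₂∞ k (I₋ K) (cliqueOr β ∘ L) β γ β≢γ (avoids d Ld) (avoids z Lz)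
          (≢-preserving⇒InjectiveOn (I₋ K) (cliqueOr β ∘ L) λ u u′ u∈ u′∈ u≢u′ →
            let Pu , u∈K = I∩⁻ (proj₁ (I₋⁻ u∈)); Pu′ , u′∈K = I∩⁻ (proj₁ (I₋⁻ u′∈)) in
            nonadjacent⇒cliques≢ u∈K u′∈K u≢u′ (I₋-in-B u∈) (I₋-in-B u′∈) (I-independent _ _ Pu Pu′))
      where
      β≢γ : β ≢ γ
      β≢γ = nonadjacent⇒cliques≢ (S⊆K d) (S⊆K z) (d≢z ∘ h-injective) Ld Lz (h-¬Adj ¬dz)
      C-in-A : ∀ {c} → C∩ K c ≡ true → L c ≡ inj₁ (partOr α (L c))
      C-in-A {c} c∈ with L c in Lc
      ... | inj₁ _ = refl
      ... | inj₂ _ = contradiction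
        (B-side-P₃-free (S⊆K d) c∈K (S⊆K z) (d≢z ∘ h-injective) Ld Lc Lz
          (Adj-sym (C-adj-S d (C∩⁻ c∈))) (C-adj-S z (C∩⁻ c∈)))
        (h-¬Adj ¬dz)
        where c∈K = proj₂ (C∩⁻ c∈)
      I₋-in-B : ∀ {u} → I₋ K u ≡ true → L u ≡ inj₂ (cliqueOr β (L u))
      I₋-in-B {u} u∈ with L u in Lu
      ... | inj₂ _ = refl
      ... | inj₁ _ =
        let u∈I , c , c∈ , ¬cu = I₋⁻ u∈
            Pu , u∈K = I∩⁻ u∈I
            Pc , c∈K = C∩⁻ c∈
        in ⊥-elim (A-side-co-P₃-free c∈K (S⊆K x) u∈K (C≢I Pc Pu ∘ sym) (I≢S x Pu) (C-in-A c∈) Lx Lu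
                     (C-adj-S x (Pc , c∈K)) (¬cu ∘ Adj-sym) (I-¬adj-S x (Pu , u∈K)))
      avoids : ∀ {q} j → L (h j) ≡ inj₂ q → ∀ u → I₋ K u ≡ true → cliqueOr β (L u) ≢ q
      avoids j Lj u u∈ =
        let Pu , u∈K = I∩⁻ (proj₁ (I₋⁻ u∈)) in
        nonadjacent⇒cliques≢ u∈K (S⊆K j) (I≢S j Pu) (I₋-in-B u∈) Lj (I-¬adj-S j (Pu , u∈K))

    cliqueSplit-from : ∀ {a b d α β δ} → L (h a) ≡ inj₁ α → L (h b) ≡ inj₁ β → L (h d) ≡ inj₂ δ →
                       C5adj a b ≡ true → CliqueSplit s k K
    cliqueSplit-from {a} {b} {d} {α} {β} {δ} La Lb Ld ab =
        count-avoiding₂ (C₊ K) (partOr α ∘ L) α β α≢β (avoids a La) (avoids b Lb)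
          (≢-preserving⇒InjectiveOn (C₊ K) (partOr α ∘ L) λ c c′ c∈ c′∈ c≢c′ →
            let Pc , c∈K = C∩⁻ (proj₁ (C₊⁻ c∈)); Pc′ , c′∈K = C∩⁻ (proj₁ (C₊⁻ c′∈)) in
            adjacent⇒parts≢ c∈K c′∈K (C₊-in-A c∈) (C₊-in-A c′∈) (C-clique c c′ Pc Pc′ c≢c′))
      , count-avoiding₁∞ k (I∩ K) (cliqueOr δ ∘ L) δ
          (λ u u∈ → nonadjacent⇒cliques≢ (proj₂ (I∩⁻ u∈)) (S⊆K d) (I≢S d (proj₁ (I∩⁻ u∈)))
                      (I-in-B u∈) Ld (I-¬adj-S d (I∩⁻ u∈)))
          (≢-preserving⇒InjectiveOn (I∩ K) (cliqueOr δ ∘ L) λ u u′ u∈ u′∈ u≢u′ →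
            let Pu , u∈K = I∩⁻ u∈; Pu′ , u′∈K = I∩⁻ u′∈ in
            nonadjacent⇒cliques≢ u∈K u′∈K u≢u′ (I-in-B u∈) (I-in-B u′∈) (I-independent _ _ Pu Pu′))
      where
      α≢β : α ≢ β
      α≢β = adjacent⇒parts≢ (S⊆K a) (S⊆K b) La Lb (h-Adj ab)
      I-in-B : ∀ {u} → I∩ K u ≡ true → L u ≡ inj₂ (cliqueOr δ (L u))
      I-in-B {u} u∈ with L u in Lu
      ... | inj₂ _ = refl
      ... | inj₁ _ =
        let Pu , u∈K = I∩⁻ u∈ in
        ⊥-elim (A-side-co-P₃-free (S⊆K a) (S⊆K b) u∈K (I≢S a Pu) (I≢S b Pu) La Lb Lu
                 (h-Adj ab) (I-¬adj-S a (Pu , u∈K)) (I-¬adj-S b (Pu , u∈K)))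
      C₊-in-A : ∀ {c} → C₊ K c ≡ true → L c ≡ inj₁ (partOr α (L c))
      C₊-in-A {c} c∈ with L c in Lc
      ... | inj₁ _ = refl
      ... | inj₂ _ =
        let c∈C , u , u∈ , cu = C₊⁻ c∈
            Pc , c∈K = C∩⁻ c∈C
            Pu , u∈K = I∩⁻ u∈
        in contradiction
             (B-side-P₃-free u∈K c∈K (S⊆K d) (I≢S d Pu) (I-in-B u∈) Lc Ld (Adj-sym cu) (C-adj-S d (Pc , c∈K)))
             (I-¬adj-S d (Pu , u∈K))
      avoids : ∀ {p} j → L (h j) ≡ inj₁ p → ∀ c → C₊ K c ≡ true → partOr α (L c) ≢ p
      avoids j Lj c c∈ =
        let c∈C = proj₁ (C₊⁻ c∈) in
        adjacent⇒parts≢ (proj₂ (C∩⁻ c∈C)) (S⊆K j) (C₊-in-A c∈) Lj (C-adj-S j (C∩⁻ c∈C))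

    h-≢ : ∀ {i j} → i ≢ j → h i ≢ h j
    h-≢ i≢j = i≢j ∘ h-injective

    -- Each of the 32 ways of distributing S₀, …, S₄ between A and B either contains one of the two
    -- configurations above or puts all of S on one side, where C₅ is neither co-P₃- nor P₃-free.
    polarOn⇒condition : PolarityCondition s k K
    polarOn⇒condition with L (h i0) in e0 | L (h i1) in e1 | L (h i2) in e2 | L (h i3) in e3 | L (h i4) in e4
    ... | inj₁ _ | inj₁ _ | inj₁ _ | inj₁ _ | inj₁ _ =
      ⊥-elim (A-side-co-P₃-free (S⊆K i0) (S⊆K i1) (S⊆K i3) (h-≢ λ ()) (h-≢ λ ()) e0 e1 e3
                (h-Adj refl) (h-¬Adj refl) (h-¬Adj refl))
    ... | inj₁ _ | inj₁ _ | inj₁ _ | inj₁ _ | inj₂ _ = inj₂ (cliqueSplit-from e0 e1 e4 refl)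
    ... | inj₁ _ | inj₁ _ | inj₁ _ | inj₂ _ | inj₁ _ = inj₂ (cliqueSplit-from e0 e1 e3 refl)
    ... | inj₁ _ | inj₁ _ | inj₁ _ | inj₂ _ | inj₂ _ = inj₂ (cliqueSplit-from e0 e1 e3 refl)
    ... | inj₁ _ | inj₁ _ | inj₂ _ | inj₁ _ | inj₁ _ = inj₂ (cliqueSplit-from e0 e1 e2 refl)
    ... | inj₁ _ | inj₁ _ | inj₂ _ | inj₁ _ | inj₂ _ = inj₂ (cliqueSplit-from e0 e1 e2 refl)
    ... | inj₁ _ | inj₁ _ | inj₂ _ | inj₂ _ | inj₁ _ = inj₂ (cliqueSplit-from e0 e1 e2 refl)
    ... | inj₁ _ | inj₁ _ | inj₂ _ | inj₂ _ | inj₂ _ = inj₂ (cliqueSplit-from e0 e1 e2 refl)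
    ... | inj₁ _ | inj₂ _ | inj₁ _ | inj₁ _ | inj₁ _ = inj₂ (cliqueSplit-from e0 e4 e1 refl)
    ... | inj₁ _ | inj₂ _ | inj₁ _ | inj₁ _ | inj₂ _ = inj₂ (cliqueSplit-from e2 e3 e1 refl)
    ... | inj₁ _ | inj₂ _ | inj₁ _ | inj₂ _ | inj₁ _ = inj₂ (cliqueSplit-from e0 e4 e1 refl)
    ... | inj₁ _ | inj₂ _ | inj₁ _ | inj₂ _ | inj₂ _ = inj₁ (cliqueOnA-from e0 e1 e3 (λ ()) refl)
    ... | inj₁ _ | inj₂ _ | inj₂ _ | inj₁ _ | inj₁ _ = inj₂ (cliqueSplit-from e0 e4 e1 refl)
    ... | inj₁ _ | inj₂ _ | inj₂ _ | inj₁ _ | inj₂ _ = inj₁ (cliqueOnA-from e0 e1 e4 (λ ()) refl)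
    ... | inj₁ _ | inj₂ _ | inj₂ _ | inj₂ _ | inj₁ _ = inj₂ (cliqueSplit-from e0 e4 e1 refl)
    ... | inj₁ _ | inj₂ _ | inj₂ _ | inj₂ _ | inj₂ _ = inj₁ (cliqueOnA-from e0 e1 e3 (λ ()) refl)
    ... | inj₂ _ | inj₁ _ | inj₁ _ | inj₁ _ | inj₁ _ = inj₂ (cliqueSplit-from e1 e2 e0 refl)
    ... | inj₂ _ | inj₁ _ | inj₁ _ | inj₁ _ | inj₂ _ = inj₂ (cliqueSplit-from e1 e2 e0 refl)
    ... | inj₂ _ | inj₁ _ | inj₁ _ | inj₂ _ | inj₁ _ = inj₂ (cliqueSplit-from e1 e2 e0 refl)
    ... | inj₂ _ | inj₁ _ | inj₁ _ | inj₂ _ | inj₂ _ = inj₂ (cliqueSplit-from e1 e2 e0 refl)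
    ... | inj₂ _ | inj₁ _ | inj₂ _ | inj₁ _ | inj₁ _ = inj₂ (cliqueSplit-from e3 e4 e0 refl)
    ... | inj₂ _ | inj₁ _ | inj₂ _ | inj₁ _ | inj₂ _ = inj₁ (cliqueOnA-from e1 e0 e2 (λ ()) refl)
    ... | inj₂ _ | inj₁ _ | inj₂ _ | inj₂ _ | inj₁ _ = inj₁ (cliqueOnA-from e1 e0 e2 (λ ()) refl)
    ... | inj₂ _ | inj₁ _ | inj₂ _ | inj₂ _ | inj₂ _ = inj₁ (cliqueOnA-from e1 e0 e2 (λ ()) refl)
    ... | inj₂ _ | inj₂ _ | inj₁ _ | inj₁ _ | inj₁ _ = inj₂ (cliqueSplit-from e2 e3 e0 refl)
    ... | inj₂ _ | inj₂ _ | inj₁ _ | inj₁ _ | inj₂ _ = inj₂ (cliqueSplit-from e2 e3 e0 refl)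
    ... | inj₂ _ | inj₂ _ | inj₁ _ | inj₂ _ | inj₁ _ = inj₁ (cliqueOnA-from e2 e0 e3 (λ ()) refl)
    ... | inj₂ _ | inj₂ _ | inj₁ _ | inj₂ _ | inj₂ _ = inj₁ (cliqueOnA-from e2 e0 e3 (λ ()) refl)
    ... | inj₂ _ | inj₂ _ | inj₂ _ | inj₁ _ | inj₁ _ = inj₂ (cliqueSplit-from e3 e4 e0 refl)
    ... | inj₂ _ | inj₂ _ | inj₂ _ | inj₁ _ | inj₂ _ = inj₁ (cliqueOnA-from e3 e0 e2 (λ ()) refl)
    ... | inj₂ _ | inj₂ _ | inj₂ _ | inj₂ _ | inj₁ _ = inj₁ (cliqueOnA-from e4 e0 e2 (λ ()) refl)
    ... | inj₂ _ | inj₂ _ | inj₂ _ | inj₂ _ | inj₂ _ =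
      contradiction (B-side-P₃-free (S⊆K i0) (S⊆K i1) (S⊆K i2) (h-≢ λ ()) e0 e1 e2 (h-Adj refl) (h-Adj refl))
                    (h-¬Adj refl)

  ¬Adj-S-I : ∀ {u w} → P u ≡ sS → P w ≡ iI → ¬ Adj G u w
  ¬Adj-S-I {u} {w} Pu Pw uw = I-anticomplete-to-S w u Pw Pu (Adj-sym uw)

  zPattern : Fin 5 → Tag 1 (fin 2)
  zPattern i0 = inj₁ zero
  zPattern i1 = inj₂ zero
  zPattern i2 = inj₁ zero
  zPattern _  = inj₂ (suc zero)

  cliqueOnA⇒polarOn : ∀ {s k K} → CliqueOnA s k K → ∃ λ L → PolarOn s k G K L
  cliqueOnA⇒polarOn {s} {k} {K} (C<s , I₋<k) = L , polarOn-byParts CC CS CI SS SI II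
    where
    open Membership K
    parts = finEnumeration C<s
    cliques = labelEnumeration k I₋<k
    part = Enumeration.enum parts
    clique = Enumeration.enum cliques
    sTag : Fin 5 → Tag s k
    sTag = Sum.map (λ _ → part 0) (clique ∘ toℕ) ∘ zPattern
    tag : Fin n → Part → Tag s k
    tag u cC = inj₁ (part (1 + rank (C∩ K) u))
    tag u sS = sTag (index u)
    tag u iI = if I₋ K u then inj₂ (clique (2 + rank (I₋ K) u)) else inj₁ (part 0)
    L : Fin n → Tag s k
    L u = tag u (P u)
    part0≢C : ∀ {u} → P u ≡ cC → K u ≡ true → part 0 ≢ part (1 + rank (C∩ K) u)
    part0≢C Pu u∈K = enum-offset-≢ parts (C∩ K) (s≤s z≤n) ≤-refl (C∩⁺ Pu u∈K)
    CC : AgreesBetween K L cC cC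
    CC u w u∈K w∈K u≢w Pu Pw rewrite Pu | Pw =
      (λ _ → enum-rank-≢ parts (C∩ K) 1 ≤-refl (C∩⁺ Pu u∈K) (C∩⁺ Pw w∈K) u≢w) ,
      λ _ → C-clique u w Pu Pw u≢w
    CS : AgreesBetween K L cC sS
    CS u w u∈K _ _ Pu Pw rewrite Pu | Pw =
      Agrees-freshPart (C-complete-to-S u w Pu Pw) (λ _ → ≢-sym (part0≢C Pu u∈K)) (zPattern (index w))
    CI : AgreesBetween K L cC iI
    CI u w u∈K w∈K _ Pu Pw rewrite Pu | Pw with I₋ K w in w∉I₋
    ... | true  = tt
    ... | false = (λ _ → ≢-sym (part0≢C Pu u∈K)) , λ _ → I₋-false (I∩⁺ Pw w∈K) w∉I₋ (C∩⁺ Pu u∈K)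
    SS : AgreesBetween K L sS sS
    SS u w _ _ u≢w Pu Pw rewrite Pu | Pw =
      S-agrees (C5Labelling-map (Fin1-injective _) (enum-toℕ-injective cliques (s≤s (s≤s z≤n)))
                  (from-yes (c5Labelling? every zPattern)))
        Pu Pw u≢w refl refl
    SI : AgreesBetween K L sS iI
    SI u w _ w∈K _ Pu Pw rewrite Pu | Pw with I₋ K w in w∈I₋
    ... | true  = Agrees-freshClique (¬Adj-S-I Pu Pw)
                    (λ i → enum-offset-≢ cliques (I₋ K) (toℕ<n i) ≤-refl w∈I₋) (zPattern (index u))
    ... | false = Agrees-samePart (¬Adj-S-I Pu Pw) (zPattern (index u))
    II : AgreesBetween K L iI iI
    II u w u∈K w∈K u≢w Pu Pw rewrite Pu | Pw with I₋ K u in u∈I₋ | I₋ K w in w∈I₋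
    ... | true  | true  = (λ uw → contradiction uw (I-independent u w Pu Pw)) ,
                          λ e → contradiction e (enum-rank-≢ cliques (I₋ K) 2 ≤-refl u∈I₋ w∈I₋ u≢w)
    ... | true  | false = tt
    ... | false | true  = tt
    ... | false | false = (λ uw → contradiction uw (I-independent u w Pu Pw)) , λ p≢p → contradiction refl p≢p

  yPattern : Fin 5 → Tag 2 (fin 1)
  yPattern i0 = inj₁ zero
  yPattern i1 = inj₁ (suc zero)
  yPattern i2 = inj₁ zero
  yPattern _  = inj₂ zero

  cliqueSplit⇒polarOn : ∀ {s k K} → CliqueSplit s k K → ∃ λ L → PolarOn s k G K L
  cliqueSplit⇒polarOn {s} {k} {K} (C₊<s , I<k) = L , polarOn-byParts CC CS CI SS SI II
    where
    open Membership K
    parts = finEnumeration C₊<s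
    cliques = labelEnumeration k I<k
    part = Enumeration.enum parts
    clique = Enumeration.enum cliques
    sTag : Fin 5 → Tag s k
    sTag = Sum.map (part ∘ toℕ) (λ _ → clique 0) ∘ yPattern
    tag : Fin n → Part → Tag s k
    tag u cC = if C₊ K u then inj₁ (part (2 + rank (C₊ K) u)) else inj₂ (clique 0)
    tag u sS = sTag (index u)
    tag u iI = inj₂ (clique (1 + rank (I∩ K) u))
    L : Fin n → Tag s k
    L u = tag u (P u)
    clique0≢I : ∀ {u} → P u ≡ iI → K u ≡ true → clique 0 ≢ clique (1 + rank (I∩ K) u)
    clique0≢I Pu u∈K = enum-offset-≢ cliques (I∩ K) (s≤s z≤n) ≤-refl (I∩⁺ Pu u∈K)
    CC : AgreesBetween K L cC cC
    CC u w u∈K w∈K u≢w Pu Pw rewrite Pu | Pw with C₊ K u in u∈C₊ | C₊ K w in w∈C₊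
    ... | true  | true  = (λ _ → enum-rank-≢ parts (C₊ K) 2 ≤-refl u∈C₊ w∈C₊ u≢w) ,
                          λ _ → C-clique u w Pu Pw u≢w
    ... | true  | false = tt
    ... | false | true  = tt
    ... | false | false = (λ _ → refl) , λ _ → C-clique u w Pu Pw u≢w
    CS : AgreesBetween K L cC sS
    CS u w u∈K _ _ Pu Pw rewrite Pu | Pw with C₊ K u in u∈C₊
    ... | true  = Agrees-freshPart (C-complete-to-S u w Pu Pw)
                    (λ i → ≢-sym (enum-offset-≢ parts (C₊ K) (toℕ<n i) ≤-refl u∈C₊)) (yPattern (index w))
    ... | false = Agrees-sameClique (C-complete-to-S u w Pu Pw) (yPattern (index w))
    CI : AgreesBetween K L cC iI
    CI u w u∈K w∈K _ Pu Pw rewrite Pu | Pw with C₊ K u in u∈C₊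
    ... | true  = tt
    ... | false = (λ uw → contradiction uw (C₊-false (C∩⁺ Pu u∈K) u∈C₊ (I∩⁺ Pw w∈K))) ,
                  λ e → contradiction e (clique0≢I Pw w∈K)
    SS : AgreesBetween K L sS sS
    SS u w _ _ u≢w Pu Pw rewrite Pu | Pw =
      S-agrees (C5Labelling-map (enum-toℕ-injective parts (s≤s (s≤s z≤n))) (Fin1-injective _)
                  (from-yes (c5Labelling? every yPattern)))
        Pu Pw u≢w refl refl
    SI : AgreesBetween K L sS iI
    SI u w _ w∈K _ Pu Pw rewrite Pu | Pw =
      Agrees-freshClique (¬Adj-S-I Pu Pw) (λ _ → clique0≢I Pw w∈K) (yPattern (index u))
    II : AgreesBetween K L iI iI
    II u w u∈K w∈K u≢w Pu Pw rewrite Pu | Pw =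
      (λ uw → contradiction uw (I-independent u w Pu Pw)) ,
      λ e → contradiction e (enum-rank-≢ cliques (I∩ K) 1 ≤-refl (I∩⁺ Pu u∈K) (I∩⁺ Pw w∈K) u≢w)

  dPattern : Fin 5 → Fin 5 → Tag 1 (fin 1)
  dPattern j₀ j = if C5adj j₀ j then inj₁ zero else inj₂ zero

  S-deletion⇒polarOn : ∀ {s k} → Fin s → Label k → ∀ j₀ → ∃ λ L → PolarOn s k G (every ─ h j₀) L
  S-deletion⇒polarOn {s} {k} p q j₀ = L , polarOn-byParts CC CS CI SS SI II
    where
    K = every ─ h j₀
    tag : Fin n → Part → Tag s k
    tag u cC = inj₂ q
    tag u sS = Sum.map (λ _ → p) (λ _ → q) (dPattern j₀ (index u))
    tag u iI = inj₁ p
    L : Fin n → Tag s k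
    L u = tag u (P u)
    index∈ : ∀ {u} → P u ≡ sS → K u ≡ true → (every ─ j₀) (index u) ≡ true
    index∈ {u} Pu u∈K with i , refl ← S⊆h u Pu rewrite index-h i =
      ∈─⁺ every refl (proj₂ (∈─⁻ every u∈K) ∘ cong h)
    CC : AgreesBetween K L cC cC
    CC u w _ _ u≢w Pu Pw rewrite Pu | Pw = (λ _ → refl) , λ _ → C-clique u w Pu Pw u≢w
    CS : AgreesBetween K L cC sS
    CS u w _ _ _ Pu Pw rewrite Pu | Pw = Agrees-sameClique (C-complete-to-S u w Pu Pw) (dPattern j₀ (index w))
    CI : AgreesBetween K L cC iI
    CI u w _ _ _ Pu Pw rewrite Pu | Pw = tt
    SS : AgreesBetween K L sS sS
    SS u w u∈K w∈K u≢w Pu Pw rewrite Pu | Pw =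
      S-agrees (C5Labelling-map (Fin1-injective _) (Fin1-injective _)
                  (from-yes (all? λ j → c5Labelling? (every ─ j) (dPattern j)) j₀))
        Pu Pw u≢w (index∈ Pu u∈K) (index∈ Pw w∈K)
    SI : AgreesBetween K L sS iI
    SI u w _ _ _ Pu Pw rewrite Pu | Pw = Agrees-samePart (¬Adj-S-I Pu Pw) (dPattern j₀ (index u))
    II : AgreesBetween K L iI iI
    II u w _ _ _ Pu Pw rewrite Pu | Pw =
      (λ uw → contradiction uw (I-independent u w Pu Pw)) , λ p≢p → contradiction refl p≢p

  condition⇒polarOn : ∀ {s k K} → PolarityCondition s k K → ∃ λ L → PolarOn s k G K L
  condition⇒polarOn (inj₁ onA)   = cliqueOnA⇒polarOn onA
  condition⇒polarOn (inj₂ split) = cliqueSplit⇒polarOn split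

-- Minimal obstructions

module Obstruction {m} (G : Graph (suc m)) (P : Fin (suc m) → Part) (ps : IsPseudoSplit G P)
  (h : Fin 5 → Fin (suc m)) (h-injective : Injective _≡_ _≡_ h) (h∈S : ∀ i → P (h i) ≡ sS)
  (S⊆h : ∀ v → P v ≡ sS → ∃ λ i → h i ≡ v) (h-adj : ∀ i j → adj G (h i) (h j) ≡ C5adj i j)
  {s : ℕ} (1<s : 1 < s) where

  open PseudoSplitGraph G P ps
  open WithC5 G P ps h h-injective h∈S S⊆h h-adj

  #C #C₊ #I : ℕ
  #C  = count (C∩ every)
  #C₊ = count (C₊ every)
  #I  = count (I∩ every)

  part₀ : Fin s
  part₀ = fromℕ< (<-≤-trans (s≤s z≤n) 1<s)

  polar⇒condition : ∀ {k} → Polar s k G → PolarityCondition s k every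
  polar⇒condition pol = let L , polarOn = polar⇒labelling G pol in
    NecessaryCondition.polarOn⇒condition (λ _ → refl) polarOn

  deletion-polar⇒condition : ∀ {k} v → P v ≢ sS → Polar s k (deleteVertex G v) →
                             PolarityCondition s k (every ─ v)
  deletion-polar⇒condition v v∉S pol =
    let L , polarOn = deletion-polar⇒labelling G v (inj₁ part₀) pol in
    NecessaryCondition.polarOn⇒condition
      (λ i → ∈─⁺ every refl λ hi≡v → v∉S (subst (λ u → P u ≡ sS) hi≡v (h∈S i))) polarOn

  condition⇒polar : ∀ {k} → PolarityCondition s k every → Polar s k G
  condition⇒polar cond = let L , polarOn = condition⇒polarOn cond in labelling⇒polar G L polarOn

  condition⇒deletion-polar : ∀ {k} v → PolarityCondition s k (every ─ v) → Polar s k (deleteVertex G v)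
  condition⇒deletion-polar v cond =
    let L , polarOn = condition⇒polarOn cond in labelling⇒deletion-polar G v L polarOn

  Pu≢ : ∀ {u a b} → P u ≡ a → a ≢ b → P u ≢ b
  Pu≢ Pu a≢b Pub = a≢b (trans (sym Pu) Pub)

  module Everywhere = Membership every
  module Without (v : Fin (suc m)) = Membership (every ─ v)

  ∈every─ : ∀ {u v : Fin (suc m)} → u ≢ v → (every ─ v) u ≡ true
  ∈every─ {u} {v} = ∈─⁺ every {v} {u} refl

  #C-without-C : ∀ {c} → P c ≡ cC → suc (count (C∩ (every ─ c))) ≡ #C
  #C-without-C {c} Pc = sym (trans (count-─ (C∩ every) c (Everywhere.C∩⁺ Pc refl))
    (cong suc (count-cong (C∩ every ─ c) (C∩ (every ─ c)) λ y → cong (_∧ _) (∧-identityʳ (isCᵇ (P y))))))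

  #C-without-nonC : ∀ {v} → P v ≢ cC → #C ≤ count (C∩ (every ─ v))
  #C-without-nonC {v} Pv≢C = count-mono (C∩ every) (C∩ (every ─ v)) λ c c∈ →
    let Pc , _ = Everywhere.C∩⁻ c∈ in Without.C∩⁺ v Pc (∈every─ {c} {v} λ { refl → Pv≢C Pc })

  #I-without-nonI : ∀ {v} → P v ≢ iI → #I ≤ count (I∩ (every ─ v))
  #I-without-nonI {v} Pv≢I = count-mono (I∩ every) (I∩ (every ─ v)) λ u u∈ →
    let Pu , _ = Everywhere.I∩⁻ u∈ in Without.I∩⁺ v Pu (∈every─ {u} {v} λ { refl → Pv≢I Pu })

  #I-without : ∀ v → count (I∩ (every ─ v)) ≤ #I
  #I-without v = count-mono (I∩ (every ─ v)) (I∩ every) λ u u∈ → Everywhere.I∩⁺ (proj₁ (Without.I∩⁻ v u∈)) refl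

  #I₋≤#I∩ : ∀ K → count (I₋ K) ≤ count (I∩ K)
  #I₋≤#I∩ K = count-mono (I₋ K) (I∩ K) λ u u∈ → ∧-conicalˡ _ _ u∈

  C₊-without : ∀ {c c′} → P c ≡ cC → C₊ every c′ ≡ true → c′ ≢ c → C₊ (every ─ c) c′ ≡ true
  C₊-without {c} {c′} Pc c′∈ c′≢c =
    let c′∈C , u , u∈I , c′u = Everywhere.C₊⁻ c′∈
        Pc′ , _ = Everywhere.C∩⁻ c′∈C
        Pu , _ = Everywhere.I∩⁻ u∈I
    in Without.C₊⁺ c (Without.C∩⁺ c Pc′ (∈every─ c′≢c))
         (Without.I∩⁺ c Pu (∈every─ (parts≢⇒≢ Pu Pc λ ()))) c′u

  minimal⇒#C₊-large : ∀ {k} → MinimalObstruction s (fin k) G → #C ≡ s → s ≤ suc #C₊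
  minimal⇒#C₊-large {k} (¬polar , dels) #C≡s with suc #C₊ <? s
  ... | no ¬C₊<s = ≮⇒≥ ¬C₊<s
  ... | yes C₊<s = ⊥-elim (no-condition (deletion-polar⇒condition c (Pu≢ Pc λ ()) (dels c)))
    where
    k≤#I : k ≤ #I
    k≤#I with suc #I ≤? k
    ... | yes I<k = contradiction (condition⇒polar (inj₂ (C₊<s , I<k))) ¬polar
    ... | no ¬I<k = ≮⇒≥ ¬I<k
    C-not-C₊ = count-<⇒∃ (C₊ every) (C∩ every) (subst (suc #C₊ ≤_) (sym #C≡s) (<⇒≤ C₊<s))
    c = proj₁ C-not-C₊
    Pc = proj₁ (Everywhere.C∩⁻ (proj₁ (proj₂ C-not-C₊)))
    no-condition : ¬ PolarityCondition s (fin k) (every ─ c)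
    no-condition (inj₂ (_ , I<k)) = 1+n≰n (≤-trans I<k (≤-trans k≤#I (#I-without-nonI (Pu≢ Pc λ ()))))
    no-condition (inj₁ (_ , I₋<k)) = 1+n≰n (≤-trans C₊<s (begin
      s                               ≡⟨ trans (sym #C≡s) (sym (#C-without-C Pc)) ⟩
      suc (count (C∩ (every ─ c)))    ≤⟨ s≤s (count-mono (C∩ (every ─ c)) (C₊ every) C-complete-to-u) ⟩
      suc #C₊                         ∎))
      where
      open ≤-Reasoning
      I-not-I₋ = count-<⇒∃ (I₋ (every ─ c)) (I∩ (every ─ c))
        (≤-trans (n≤1+n _) (≤-trans I₋<k (≤-trans k≤#I (#I-without-nonI (Pu≢ Pc λ ())))))
      u = proj₁ I-not-I₋
      C-complete-to-u : ∀ c′ → C∩ (every ─ c) c′ ≡ true → C₊ every c′ ≡ true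
      C-complete-to-u c′ c′∈ =
        let u∈ , u∉ = proj₂ I-not-I₋
            Pc′ , _ = Without.C∩⁻ c c′∈
            Pu , _ = Without.I∩⁻ c u∈
        in Everywhere.C₊⁺ (Everywhere.C∩⁺ Pc′ refl) (Everywhere.I∩⁺ Pu refl) (Without.I₋-false c u∈ u∉ c′∈)

  minimal⇒¬polar : ∀ {k k′} → MinimalObstruction s (fin k) G → #C ≡ s → ¬ Polar s k′ G
  minimal⇒¬polar minimal #C≡s pol with polar⇒condition pol
  ... | inj₁ (C<s , _)  = 1+n≰n (subst (_< s) #C≡s C<s)
  ... | inj₂ (C₊<s , _) = 1+n≰n (≤-trans C₊<s (minimal⇒#C₊-large minimal #C≡s))

  record PrivateNeighbour (i c : Fin (suc m)) : Set where
    field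
      c∈C₊   : C₊ every c ≡ true
      c-adj-i : Adj G c i
      unique  : ∀ u → P u ≡ iI → Adj G c u → u ≡ i

  module Deletions {k₀} (#C≡s : #C ≡ s) (C₊-large : s ≤ suc #C₊)
                   (dels : ∀ v → Polar s k₀ (deleteVertex G v)) where

    C₊-without-I : ∀ {i} → P i ≡ iI → 2 + count (C₊ (every ─ i)) ≤ s
    C₊-without-I {i} Pi with deletion-polar⇒condition i (Pu≢ Pi λ ()) (dels i)
    ... | inj₂ (C₊<s , _) = C₊<s
    ... | inj₁ (C<s , _)  = ⊥-elim (1+n≰n (≤-trans C<s (subst (_≤ _) #C≡s (#C-without-nonC (Pu≢ Pi λ ())))))

    private-neighbour : ∀ {i} → P i ≡ iI → ∃ (PrivateNeighbour i)
    private-neighbour {i} Pi = c , record { c∈C₊ = c∈C₊ ; c-adj-i = c-adj-i ; unique = unique }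
      where
      lost = count-<⇒∃ (C₊ (every ─ i)) (C₊ every) (≤-pred (≤-trans (C₊-without-I Pi) C₊-large))
      c = proj₁ lost
      c∈C₊ = proj₁ (proj₂ lost)
      Pc = proj₁ (Everywhere.C∩⁻ (proj₁ (Everywhere.C₊⁻ c∈C₊)))
      unique : ∀ u → P u ≡ iI → Adj G c u → u ≡ i
      unique u Pu cu with u ≟ i
      ... | yes u≡i = u≡i
      ... | no u≢i = contradiction cu
        (Without.C₊-false i (Without.C∩⁺ i Pc (∈every─ (parts≢⇒≢ Pc Pi λ ()))) (proj₂ (proj₂ lost))
          (Without.I∩⁺ i Pu (∈every─ u≢i)))
      c-adj-i : Adj G c i
      c-adj-i = let _ , u , u∈I , cu = Everywhere.C₊⁻ c∈C₊ in
        subst (Adj G c) (unique u (proj₁ (Everywhere.I∩⁻ u∈I)) cu) cu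

    private-neighbour-or-self : ∀ u → ∃ λ c → P u ≡ iI → PrivateNeighbour u c
    private-neighbour-or-self u with P u in Pu
    ... | iI = let c , c-private = private-neighbour Pu in c , λ _ → c-private
    ... | cC = u , λ ()
    ... | sS = u , λ ()

    privateNeighbour : Fin (suc m) → Fin (suc m)
    privateNeighbour u = proj₁ (private-neighbour-or-self u)

    privateNeighbour-spec : ∀ {u} → P u ≡ iI → PrivateNeighbour u (privateNeighbour u)
    privateNeighbour-spec {u} = proj₂ (private-neighbour-or-self u)

    privateNeighbour-into-C : ∀ u → I∩ every u ≡ true → C∩ every (privateNeighbour u) ≡ true
    privateNeighbour-into-C u u∈ =
      proj₁ (Everywhere.C₊⁻ (PrivateNeighbour.c∈C₊ (privateNeighbour-spec (proj₁ (Everywhere.I∩⁻ u∈)))))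

    privateNeighbour-injective : InjectiveOn (I∩ every) privateNeighbour
    privateNeighbour-injective u w u∈ w∈ e =
      let Pu = proj₁ (Everywhere.I∩⁻ u∈); Pw = proj₁ (Everywhere.I∩⁻ w∈) in
      PrivateNeighbour.unique (privateNeighbour-spec Pw) u Pu
        (subst (λ c → Adj G c u) e (PrivateNeighbour.c-adj-i (privateNeighbour-spec Pu)))

    #I<s : #I < s
    #I<s with #I <? s
    ... | yes I<s = I<s
    ... | no ¬I<s = ⊥-elim (1+n≰n (≤-trans (C₊-without-I Pi) (begin
      s                                ≡⟨ trans (sym #C≡s) (sym (#C-without-C Pc₀)) ⟩
      suc (count (C∩ (every ─ c₀)))    ≤⟨ s≤s (count-mono (C∩ (every ─ c₀)) (C₊ (every ─ i)) C-c₀⊆C₊-i) ⟩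
      suc (count (C₊ (every ─ i)))     ∎)))
      where
      open ≤-Reasoning
      s≤#I = ≮⇒≥ ¬I<s
      some-i = count>0⇒∃ (I∩ every) (≤-trans (<-≤-trans (s≤s z≤n) 1<s) s≤#I)
      i = proj₁ some-i
      Pi = proj₁ (Everywhere.I∩⁻ (proj₂ some-i))
      c₀ = privateNeighbour i
      Pc₀ = proj₁ (Everywhere.C∩⁻ (privateNeighbour-into-C i (proj₂ some-i)))
      C-c₀⊆C₊-i : ∀ c → C∩ (every ─ c₀) c ≡ true → C₊ (every ─ i) c ≡ true
      C-c₀⊆C₊-i c c∈ =
        let Pc , c∈K = Without.C∩⁻ c₀ c∈
            j , j∈I , j↦c = injection-onto (I∩ every) (C∩ every) privateNeighbour privateNeighbour-into-C
                              privateNeighbour-injective (subst (_≤ #I) (sym #C≡s) s≤#I) c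
                              (Everywhere.C∩⁺ Pc refl)
            Pj = proj₁ (Everywhere.I∩⁻ j∈I)
        in Without.C₊⁺ i (Without.C∩⁺ i Pc (∈every─ (parts≢⇒≢ Pc Pi λ ())))
             (Without.I∩⁺ i Pj (∈every─ λ j≡i →
               proj₂ (∈─⁻ every c∈K) (trans (sym j↦c) (cong privateNeighbour j≡i))))
             (subst (λ c → Adj G c j) j↦c (PrivateNeighbour.c-adj-i (privateNeighbour-spec Pj)))

    deletions-polar : ∀ v → Polar s (fin (suc s)) (deleteVertex G v)
    deletions-polar v with P v in Pv
    ... | cC = condition⇒deletion-polar v (inj₁
          ( ≤-reflexive (trans (#C-without-C Pv) #C≡s)
          , s≤s (≤-<-trans (≤-trans (#I₋≤#I∩ (every ─ v)) (#I-without v)) #I<s)))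
    ... | iI = condition⇒deletion-polar v (inj₂
          (C₊-without-I Pv , s≤s (≤-trans (#I-without v) (<⇒≤ #I<s))))
    ... | sS with j₀ , refl ← S⊆h v Pv =
      let L , polarOn = S-deletion⇒polarOn part₀ zero j₀ in labelling⇒deletion-polar G (h j₀) L polarOn

  ¬polar∞⇒#C₊-large : ¬ Polar s ∞ G → s ≤ suc #C₊
  ¬polar∞⇒#C₊-large ¬polar with suc #C₊ <? s
  ... | yes C₊<s = ⊥-elim (¬polar (condition⇒polar (inj₂ (C₊<s , tt))))
  ... | no ¬C₊<s = ≮⇒≥ ¬C₊<s

  minimal∞⇒#C≡s : MinimalObstruction s ∞ G → #C ≡ s
  minimal∞⇒#C≡s (¬polar , dels) = ≤-antisym #C≤s s≤#C
    where
    C₊-large = ¬polar∞⇒#C₊-large ¬polar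
    s≤#C : s ≤ #C
    s≤#C with #C <? s
    ... | yes C<s = ⊥-elim (¬polar (condition⇒polar (inj₁ (C<s , tt))))
    ... | no ¬C<s = ≮⇒≥ ¬C<s
    #C≤s : #C ≤ s
    #C≤s with #C ≤? s
    ... | yes C≤s = C≤s
    ... | no C≰s = ⊥-elim (1+n≰n (≤-trans (C₊-without-C Pc′) (≤-trans C₊-large (s≤s C₊⊆C₊-c′))))
      where
      s<#C = ≰⇒> C≰s
      C₊-without-C : ∀ {c} → P c ≡ cC → 2 + count (C₊ (every ─ c)) ≤ s
      C₊-without-C {c} Pc with deletion-polar⇒condition c (Pu≢ Pc λ ()) (dels c)
      ... | inj₂ (C₊<s , _) = C₊<s
      ... | inj₁ (C<s , _)  = ⊥-elim (1+n≰n (≤-trans s<#C (subst (_≤ s) (#C-without-C Pc) C<s)))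
      some-c₁ = count>0⇒∃ (C₊ every) (≤-pred (<-≤-trans 1<s C₊-large))
      c₁ = proj₁ some-c₁
      Pc₁ = proj₁ (Everywhere.C∩⁻ (proj₁ (Everywhere.C₊⁻ (proj₂ some-c₁))))
      #C₊≤ : #C₊ ≤ suc (count (C₊ (every ─ c₁)))
      #C₊≤ = subst (_≤ suc (count (C₊ (every ─ c₁)))) (sym (count-─ (C₊ every) c₁ (proj₂ some-c₁)))
        (s≤s (count-mono (C₊ every ─ c₁) (C₊ (every ─ c₁)) λ c c∈ →
          let c∈C₊ , c≢c₁ = ∈─⁻ (C₊ every) c∈ in C₊-without Pc₁ c∈C₊ c≢c₁))
      C-not-C₊ = count-<⇒∃ (C₊ every) (C∩ every)
        (≤-trans (s≤s #C₊≤) (≤-trans (C₊-without-C Pc₁) (<⇒≤ s<#C)))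
      c′ = proj₁ C-not-C₊
      Pc′ = proj₁ (Everywhere.C∩⁻ (proj₁ (proj₂ C-not-C₊)))
      C₊⊆C₊-c′ : #C₊ ≤ count (C₊ (every ─ c′))
      C₊⊆C₊-c′ = count-mono (C₊ every) (C₊ (every ─ c′)) λ c c∈ →
        C₊-without Pc′ c∈ λ { refl → contradiction (trans (sym c∈) (proj₂ (proj₂ C-not-C₊))) λ () }

  minimal⇒deletions-polar : ∀ {k} → MinimalObstruction s (fin k) G → #C ≡ s →
                            AllDeletionsPolar s (fin (suc s)) G
  minimal⇒deletions-polar minimal #C≡s =
    Deletions.deletions-polar #C≡s (minimal⇒#C₊-large minimal #C≡s) (proj₂ minimal)

  minimal∞⇒minimal : MinimalObstruction s ∞ G → MinimalObstruction s (fin (suc s)) G × #C ≡ s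
  minimal∞⇒minimal (¬polar , dels) =
    let #C≡s = minimal∞⇒#C≡s (¬polar , dels) in
    (¬polar ∘ polar-fin⇒∞ G , Deletions.deletions-polar #C≡s (¬polar∞⇒#C₊-large ¬polar) dels) , #C≡s

split⇒¬minimal : ∀ {n s k} (G : Graph n) (P : Fin n → Part) → IsPseudoSplit G P → (∀ v → P v ≢ sS) →
  0 < s → 1 ≤∞ k → ¬ MinimalObstruction s k G
split⇒¬minimal {k = k} G P ps noS 0<s 1≤k (¬polar , _) =
  ¬polar (PseudoSplitGraph.split⇒polar G P ps noS (fromℕ< 0<s) (Enumeration.enum (labelEnumeration k 1≤k) 0))

module _ {s} (1<s : 1 < s) where

  minimal-fin⇒¬polar : ∀ {n k k′} (G : Graph n) (P : Fin n → Part) → IsPseudoSplit G P → 0 < k →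
    MinimalObstruction s (fin k) G → sizeC P ≡ s → ¬ Polar s k′ G
  minimal-fin⇒¬polar G P ps 0<k minimal C≡s with proj₁ (proj₂ (proj₂ ps))
  ... | inj₁ noS = ⊥-elim (split⇒¬minimal G P ps noS (≤-<-trans z≤n 1<s) 0<k minimal)
  minimal-fin⇒¬polar {zero}  G P ps 0<k minimal C≡s | inj₂ (h , _) with () ← h zero
  minimal-fin⇒¬polar {suc m} G P ps 0<k minimal C≡s | inj₂ (h , h-inj , h∈S , S⊆h , h-adj) =
    Obstruction.minimal⇒¬polar G P ps h h-inj h∈S S⊆h h-adj 1<s minimal (trans (sym (sizeC≡count P)) C≡s)

  minimal-fin⇒deletions-polar : ∀ {n k} (G : Graph n) (P : Fin n → Part) → IsPseudoSplit G P → 0 < k →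
    MinimalObstruction s (fin k) G → sizeC P ≡ s → AllDeletionsPolar s (fin (suc s)) G
  minimal-fin⇒deletions-polar G P ps 0<k minimal C≡s with proj₁ (proj₂ (proj₂ ps))
  ... | inj₁ noS = ⊥-elim (split⇒¬minimal G P ps noS (≤-<-trans z≤n 1<s) 0<k minimal)
  minimal-fin⇒deletions-polar {zero}  G P ps 0<k minimal C≡s | inj₂ (h , _) with () ← h zero
  minimal-fin⇒deletions-polar {suc m} G P ps 0<k minimal C≡s | inj₂ (h , h-inj , h∈S , S⊆h , h-adj) =
    Obstruction.minimal⇒deletions-polar G P ps h h-inj h∈S S⊆h h-adj 1<s minimal
      (trans (sym (sizeC≡count P)) C≡s)

  minimal∞⇒minimal-fin : ∀ {n} (G : Graph n) (P : Fin n → Part) → IsPseudoSplit G P →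
    MinimalObstruction s ∞ G → MinimalObstruction s (fin (suc s)) G × sizeC P ≡ s
  minimal∞⇒minimal-fin G P ps minimal with proj₁ (proj₂ (proj₂ ps))
  ... | inj₁ noS = ⊥-elim (split⇒¬minimal G P ps noS (≤-<-trans z≤n 1<s) _ minimal)
  minimal∞⇒minimal-fin {zero}  G P ps minimal | inj₂ (h , _) with () ← h zero
  minimal∞⇒minimal-fin {suc m} G P ps minimal | inj₂ (h , h-inj , h∈S , S⊆h , h-adj) =
    let minimal′ , #C≡s = Obstruction.minimal∞⇒minimal G P ps h h-inj h∈S S⊆h h-adj 1<s minimal in
    minimal′ , trans (sizeC≡count P) #C≡s

mainTheorem7 : (s k : ℕ) → 3 ≤ s → s < k →
    ∀ {n} (G : Graph n) (P : Fin n → Part) → IsPseudoSplit G P →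
      -- (1)
      ((MinimalObstruction s (fin k) G → sizeC P ≡ s →
          ∀ k′ → k ≤ k′ → MinimalObstruction s (fin k′) G)
      × (MinimalObstruction s (fin (suc s)) G → sizeC P ≡ s →
          MinimalObstruction s ∞ G))
      -- (2)
    × ((MinimalObstruction s (fin k) G → sizeC P ≡ s →
          MinimalObstruction s (fin (suc s)) G)
      × (MinimalObstruction s ∞ G →
          MinimalObstruction s (fin (suc s)) G × sizeC P ≡ s))
      -- hence
    × ((MinimalObstruction s ∞ G →
          MinimalObstruction s (fin (suc s)) G × sizeC P ≡ s)
      × (MinimalObstruction s (fin (suc s)) G × sizeC P ≡ s →
          MinimalObstruction s ∞ G))
mainTheorem7 s k 3≤s s<k G P ps =
    (raise , fin⇒∞) , (lower , ∞⇒fin) , (∞⇒fin , λ (minimal , C≡s) → fin⇒∞ minimal C≡s)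
  where
  1<s : 1 < s
  1<s = <-≤-trans (s≤s (s≤s z≤n)) 3≤s
  0<k : 0 < k
  0<k = ≤-<-trans z≤n s<k
  raise : MinimalObstruction s (fin k) G → sizeC P ≡ s → ∀ k′ → k ≤ k′ → MinimalObstruction s (fin k′) G
  raise minimal C≡s k′ k≤k′ =
    minimal-fin⇒¬polar 1<s G P ps 0<k minimal C≡s ,
    allDeletionsPolar-map (λ H → polar-mono H k≤k′) G (proj₂ minimal)
  fin⇒∞ : MinimalObstruction s (fin (suc s)) G → sizeC P ≡ s → MinimalObstruction s ∞ G
  fin⇒∞ minimal C≡s =
    minimal-fin⇒¬polar 1<s G P ps (s≤s z≤n) minimal C≡s , allDeletionsPolar-map polar-fin⇒∞ G (proj₂ minimal)
  lower : MinimalObstruction s (fin k) G → sizeC P ≡ s → MinimalObstruction s (fin (suc s)) G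
  lower minimal C≡s =
    minimal-fin⇒¬polar 1<s G P ps 0<k minimal C≡s , minimal-fin⇒deletions-polar 1<s G P ps 0<k minimal C≡s
  ∞⇒fin : MinimalObstruction s ∞ G → MinimalObstruction s (fin (suc s)) G × sizeC P ≡ s
  ∞⇒fin = minimal∞⇒minimal-fin 1<s G P ps
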